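{- (a) For every integer $v\equiv 4\pmod 6$ with $v\neq 4$ and every positive integer $\lambda\equiv 2,4\pmod 6$, there exists a $\mathrm{TS}(v,\lambda)$ with a zero-sum $5$-flow. (b) For every integer $v\equiv 1\pmod 6$ with $v\neq 7,19$ and every positive integer $\lambda\equiv 2,4\pmod 6$, there exists a $\mathrm{TS}(v,\lambda)$ with a zero-sum $3$-flow.
   Context: A $\mathrm{TS}(v,\lambda)$ (triple system) is a pair $(X,\mathcal B)$ where $X$ is a set of $v$ points and $\mathcal B$ is a collection (multiset) of $3$-subsets of $X$, called blocks, such that every $2$-subset of $X$ is contained in exactly $\lambda$ blocks. For a positive integer $n$, a zero-sum $n$-flow of such a design is a map $f:\mathcal B\to\{\pm1,\dots,\pm(n-1)\}$ such that for every point $x\in X$, $\sum_{B\in\mathcal B,\,x\in B} f(B)=0$. -}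

module Defs where

open import Data.Nat using (ℕ; zero; suc; _<_; _%_)
open import Data.Integer using (ℤ; +_; -_; _+_; ∣_∣)
open import Data.Fin using (Fin; _≟_)
open import Data.Fin.Properties using () 
open import Data.Bool using (Bool; true; false; _∨_; _∧_; if_then_else_)
open import Data.List using (List; []; _∷_; length; lookup)
open import Data.Product using (Σ; _×_; _,_; ∃)
open import Relation.Nullary using (¬_)
open import Relation.Nullary.Decidable using (⌊_⌋)
open import Relation.Binary.PropositionalEquality using (_≡_; _≢_)

-- A block: a 3-subset {a, b, c} of the point set Fin v, represented as a
-- triple of pairwise distinct points (order is irrelevant for all notions below).
record Block (v : ℕ) : Set where
  constructor block
  field
    p₁ p₂ p₃ : Fin v
    p₁≢p₂ : p₁ ≢ p₂
    p₁≢p₃ : p₁ ≢ p₃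
    p₂≢p₃ : p₂ ≢ p₃

_∈ᵇ_ : {v : ℕ} → Fin v → Block v → Bool
x ∈ᵇ block a b c _ _ _ = ⌊ x ≟ a ⌋ ∨ ⌊ x ≟ b ⌋ ∨ ⌊ x ≟ c ⌋

pairCount : {v : ℕ} → List (Block v) → Fin v → Fin v → ℕ
pairCount [] x y = 0
pairCount (B ∷ Bs) x y =
  if (x ∈ᵇ B) ∧ (y ∈ᵇ B) then suc (pairCount Bs x y) else pairCount Bs x y

IsTS : (v lam : ℕ) → List (Block v) → Set
IsTS v lam ℬ = (x y : Fin v) → x ≢ y → pairCount ℬ x y ≡ lam

flowAt : {v : ℕ} → (ℬ : List (Block v)) → (Fin (length ℬ) → ℤ) → Fin v → ℤ
flowAt [] f x = + 0
flowAt (B ∷ Bs) f x =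
  (if x ∈ᵇ B then f Fin.zero else + 0) + flowAt Bs (λ i → f (Fin.suc i)) x
  where import Data.Fin as Fin

IsZeroSumFlow : {v : ℕ} → ℕ → (ℬ : List (Block v)) → (Fin (length ℬ) → ℤ) → Set
IsZeroSumFlow {v} n ℬ f =
  ((i : Fin (length ℬ)) → ¬ (f i ≡ + 0) × ∣ f i ∣ < n)
  × ((x : Fin v) → flowAt ℬ f x ≡ + 0)

HasTSWithFlow : (v lam n : ℕ) → Set
HasTSWithFlow v lam n =
  Σ (List (Block v)) λ ℬ → IsTS v lam ℬ × Σ (Fin (length ℬ) → ℤ) (IsZeroSumFlow n ℬ)

-- Both designs are built for λ = 2 and then repeated λ/2 times.
--
-- (b) v = 6t + 1. In ℤ/vℤ the 2t triangles {0, a, 2a + t} and {0, a, 2a + 3t}, 1 ≤ a ≤ t, form a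
-- 2-fold difference family: their differences ±a, ±(a + t), ±(2a + t) and ±a, ±(a + 3t), ±(2a + 3t)
-- cover every nonzero residue exactly twice. Weighting all translates of the first triangles by 1
-- and those of the second by −1 is a zero-sum 3-flow, as every point lies in three translates of
-- each triangle.
--
-- (a) v = 3n + 1, n = 2u + 1. On {∞} ∪ ℤ/nℤ × ℤ/3ℤ take, for s ∈ ℤ/nℤ and l ∈ ℤ/3ℤ, the block
-- {∞, (s, l), (s, l + 1)} with weight g(s), the block {(s, 0), (s, 1), (s, 2)} with weight −2g(s),
-- and, once with weight 1 and once with weight −1, the blocks {(s − c, l), (s + c, l), (s, l + 1)}
-- for 1 ≤ c ≤ u; here g takes the values ±1, ±2 and sums to 0. The last family covers the pairs on
-- one level through the differences ±2c and the pairs on adjacent levels through ±c, each twice;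
-- the first two cover the pairs through ∞ and the pairs with equal residues. The flow is
-- 2g(x) − 2g(x) at (x, l) and 3 Σ g at ∞.

module Submission where

open import Defs
open import Data.Nat using (ℕ; _%_)
open import Data.Product using (_×_)
open import Data.Sum using (_⊎_)
open import Relation.Binary.PropositionalEquality using (_≡_; _≢_)

open import Data.Bool using (true; false; if_then_else_)
open import Data.Empty using (⊥-elim)
open import Data.Fin using (Fin; zero; suc; _≟_; toℕ; fromℕ<; combine; remQuot)
open import Data.Fin.Patterns using (0F; 1F; 2F)
import Data.Fin.Properties as FinP
open import Data.Integer as ℤ using (ℤ; +_; 1ℤ; -1ℤ) renaming (_+_ to _+ℤ_; _*_ to _*ℤ_)
import Data.Integer.Properties as ℤP
open import Data.List using (List; []; _∷_; _++_; map; length; concat; tabulate)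
open import Data.List.Relation.Unary.All using (All; []; _∷_)
open import Data.List.Relation.Unary.All.Properties using (++⁺; concat⁺; tabulate⁺)
open import Data.Nat using (NonZero; zero; suc; _+_; _*_; _∸_; _≤_; _<_; z≤n; s≤s; s≤s⁻¹; z<s)
open import Data.Nat.DivMod using (_/_; m%n<n; %-distribˡ-+; m%n%n≡m%n; [m+n]%n≡m%n; m<n⇒m%n≡m; m≡m%n+[m/n]*n)
open import Data.Nat.Properties renaming (_≟_ to _≟ℕ_)
open import Data.Nat.Tactic.RingSolver using (solve-∀)
open import Data.Product using (Σ; _,_; proj₁; proj₂)
open import Data.Sum using (inj₁; inj₂)
open import Function using (_∘_; _⇔_; mk⇔)
open import Relation.Binary.PropositionalEquality using (refl; sym; trans; cong; cong₂; subst; module ≡-Reasoning)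
open import Relation.Nullary using (¬_; Dec; does; yes; no; _×-dec_)
open import Relation.Nullary.Decidable using (dec-true; dec-false; does-⇔)

open import Algebra.Properties.CommutativeSemigroup +-commutativeSemigroup using (interchange)
open import Algebra.Properties.Semiring.Sum +-*-semiring
import Algebra.Properties.Semiring.Sum ℤP.+-*-semiring as ℤΣ

[_] : {P : Set} → Dec P → ℕ
[ P? ] = if does P? then 1 else 0

[]-yes : {P : Set} (P? : Dec P) → P → [ P? ] ≡ 1
[]-yes P? p rewrite dec-true P? p = refl

[]-no : {P : Set} (P? : Dec P) → ¬ P → [ P? ] ≡ 0
[]-no P? ¬p rewrite dec-false P? ¬p = refl

[]-⇔ : {P Q : Set} → P ⇔ Q → (P? : Dec P) (Q? : Dec Q) → [ P? ] ≡ [ Q? ]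
[]-⇔ P⇔Q P? Q? = cong (λ b → if b then 1 else 0) (does-⇔ P⇔Q P? Q?)

[]-× : {P Q : Set} (P? : Dec P) (Q? : Dec Q) → [ P? ×-dec Q? ] ≡ [ P? ] * [ Q? ]
[]-× P? Q? with does P? | does Q?
... | true  | true  = refl
... | true  | false = refl
... | false | _     = refl

[≟]-sym : ∀ {A : Set} (_≟ᴬ_ : (a b : A) → Dec (a ≡ b)) x y → [ x ≟ᴬ y ] ≡ [ y ≟ᴬ x ]
[≟]-sym _≟ᴬ_ x y = []-⇔ (mk⇔ sym sym) (x ≟ᴬ y) (y ≟ᴬ x)

∑-const : ∀ k c → ∑[ i < k ] c ≡ k * c
∑-const zero c = refl
∑-const (suc k) c = cong (_+_ c) (∑-const k c)

∑*∑ : ∀ {k l} (f : Fin k → ℕ) (g : Fin l → ℕ) → (∑[ i < k ] f i) * (∑[ j < l ] g j) ≡ ∑[ i < k ] ∑[ j < l ] (f i * g j)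
∑*∑ {k} f g = trans (*-distribʳ-sum (sum g) f) (sum-cong-≗ {k} λ i → *-distribˡ-sum (f i) g)

∑-distrib-+₃ : ∀ {k} (f g h : Fin k → ℕ) → ∑[ i < k ] (f i + g i + h i) ≡ ∑[ i < k ] f i + ∑[ i < k ] g i + ∑[ i < k ] h i
∑-distrib-+₃ f g h = trans (∑-distrib-+ (λ i → f i + g i) h) (cong (_+ sum h) (∑-distrib-+ f g))

∑₃∑₃ : (T : Fin 3 → Fin 3 → ℕ) → ∑[ i < 3 ] ∑[ j < 3 ] T i j ≡
  T 0F 0F + T 1F 1F + T 2F 2F + (T 0F 1F + T 0F 2F + T 1F 2F + T 1F 0F + T 2F 0F + T 2F 1F)
∑₃∑₃ T = regroup (T 0F 0F) (T 0F 1F) (T 0F 2F) (T 1F 0F) (T 1F 1F) (T 1F 2F) (T 2F 0F) (T 2F 1F) (T 2F 2F)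
  where
  regroup : ∀ a b c d e f g h i → a + (b + (c + 0)) + (d + (e + (f + 0)) + (g + (h + (i + 0)) + 0)) ≡
                                  a + e + i + (b + c + f + d + g + h)
  regroup = solve-∀

∑-select : ∀ {k} (z : Fin k) (h : Fin k → ℕ) → ∑[ s < k ] ([ s ≟ z ] * h s) ≡ h z
∑-select {suc k} zero h = trans (cong (_+_ (1 * h zero)) (sum-replicate-zero k)) (trans (+-identityʳ _) (+-identityʳ _))
∑-select {suc k} (suc z) h = ∑-select z (h ∘ suc)

∑-zero : ∀ {k} {f : Fin k → ℕ} → (∀ i → f i ≡ 0) → ∑[ i < k ] f i ≡ 0
∑-zero {k} f≡0 = trans (sum-cong-≗ {k} f≡0) (sum-replicate-zero k)

∑-select-const : ∀ {k} (x : Fin k) c → ∑[ s < k ] ([ x ≟ s ] * c) ≡ c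
∑-select-const {k} x c = trans (sum-cong-≗ {k} λ s → cong (_* c) ([≟]-sym _≟_ x s)) (∑-select x (λ _ → c))

∑-select-pair : ∀ {k} (x y : Fin k) a b → ∑[ s < k ] (([ x ≟ s ] * a) * ([ y ≟ s ] * b)) ≡ [ y ≟ x ] * (a * b)
∑-select-pair {k} x y a b = trans
  (sum-cong-≗ {k} λ s → trans (reorder [ x ≟ s ] a [ y ≟ s ] b) (cong (_* ([ y ≟ s ] * (a * b))) ([≟]-sym _≟_ x s)))
  (∑-select x (λ s → [ y ≟ s ] * (a * b)))
  where
  reorder : ∀ p a q b → (p * a) * (q * b) ≡ p * (q * (a * b))
  reorder = solve-∀

ℤ∑-select : ∀ {k} (z : Fin k) (h : Fin k → ℤ) → ℤΣ.sum (λ s → + [ s ≟ z ] *ℤ h s) ≡ h z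
ℤ∑-select {suc k} zero h = trans (cong₂ _+ℤ_ (ℤP.*-identityˡ (h zero)) (ℤΣ.sum-replicate-zero k)) (ℤP.+-identityʳ (h zero))
ℤ∑-select {suc k} (suc z) h = trans (ℤP.+-identityˡ _) (ℤ∑-select z (h ∘ suc))

ℤ∑-select-scaled : ∀ {k} (x : Fin k) m (h : Fin k → ℤ) → ℤΣ.sum (λ s → + ([ x ≟ s ] * m) *ℤ h s) ≡ + m *ℤ h x
ℤ∑-select-scaled {k} x m h = trans (ℤΣ.sum-cong-≗ {k} pull) (ℤ∑-select x (λ s → + m *ℤ h s))
  where
  pull : ∀ s → + ([ x ≟ s ] * m) *ℤ h s ≡ + [ s ≟ x ] *ℤ (+ m *ℤ h s)
  pull s = begin
    + ([ x ≟ s ] * m) *ℤ h s          ≡⟨ cong (_*ℤ h s) (ℤP.pos-* [ x ≟ s ] m) ⟩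
    + [ x ≟ s ] *ℤ + m *ℤ h s         ≡⟨ ℤP.*-assoc (+ [ x ≟ s ]) (+ m) (h s) ⟩
    + [ x ≟ s ] *ℤ (+ m *ℤ h s)       ≡⟨ cong (λ b → + b *ℤ (+ m *ℤ h s)) ([≟]-sym _≟_ x s) ⟩
    + [ s ≟ x ] *ℤ (+ m *ℤ h s)       ∎
    where open ≡-Reasoning

∑-pos : ∀ {k} (f : Fin k → ℕ) → ℤΣ.sum (λ i → + f i) ≡ + ∑[ i < k ] f i
∑-pos {zero} f = refl
∑-pos {suc k} f = trans (cong (_+ℤ_ (+ f zero)) (∑-pos (f ∘ suc))) (sym (ℤP.pos-+ (f zero) _))

ℤ∑-scale : ∀ {k} (f : Fin k → ℕ) w → ℤΣ.sum (λ i → + f i *ℤ w) ≡ + (∑[ i < k ] f i) *ℤ w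
ℤ∑-scale f w = trans (sym (ℤΣ.*-distribʳ-sum w (λ i → + f i))) (cong (_*ℤ w) (∑-pos f))

⋃ : ∀ {A : Set} k → (Fin k → List A) → List A
⋃ k F = concat (tabulate F)

syntax ⋃ k (λ i → F) = ⋃[ i < k ] F

-- A multiset of blocks, each occurrence carrying the value of the flow on it.
WeightedBlocks : ℕ → Set
WeightedBlocks v = List (Block v × ℤ)

incidence : ∀ {v} → Fin v → Block v → ℕ
incidence x (block a b c _ _ _) = [ x ≟ a ] + [ x ≟ b ] + [ x ≟ c ]

pairs : ∀ {v} → WeightedBlocks v → Fin v → Fin v → ℕ
pairs [] x y = 0
pairs ((B , _) ∷ W) x y = incidence x B * incidence y B + pairs W x y

flow : ∀ {v} → WeightedBlocks v → Fin v → ℤ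
flow [] x = + 0
flow ((B , w) ∷ W) x = + incidence x B *ℤ w +ℤ flow W x

ValidWeight : ℕ → ℤ → Set
ValidWeight n w = ¬ w ≡ + 0 × ℤ.∣ w ∣ < n

record TS₂WithFlow (n : ℕ) {v : ℕ} (W : WeightedBlocks v) : Set where
  field
    pairs≡2 : ∀ x y → x ≢ y → pairs W x y ≡ 2
    flow≡0  : ∀ x → flow W x ≡ + 0
    valid   : All (ValidWeight n ∘ proj₂) W

incidence-∈ᵇ : ∀ {v} (x : Fin v) B → (if x ∈ᵇ B then 1 else 0) ≡ incidence x B
incidence-∈ᵇ x (block a b c a≢b a≢c b≢c) with x ≟ a | x ≟ b | x ≟ c
... | yes refl | yes refl | _        = ⊥-elim (a≢b refl)
... | yes refl | no _     | yes refl = ⊥-elim (a≢c refl)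
... | no _     | yes refl | yes refl = ⊥-elim (b≢c refl)
... | yes _    | no _     | no _     = refl
... | no _     | yes _    | no _     = refl
... | no _     | no _     | yes _    = refl
... | no _     | no _     | no _     = refl

pairCount≡pairs : ∀ {v} (W : WeightedBlocks v) x y → pairCount (map proj₁ W) x y ≡ pairs W x y
pairCount≡pairs [] x y = refl
pairCount≡pairs ((B , _) ∷ W) x y
  rewrite sym (incidence-∈ᵇ x B) | sym (incidence-∈ᵇ y B) | pairCount≡pairs W x y
  with x ∈ᵇ B | y ∈ᵇ B
... | true  | true  = refl
... | true  | false = refl
... | false | _     = refl

weights : ∀ {v} (W : WeightedBlocks v) → Fin (length (map proj₁ W)) → ℤ
weights ((_ , w) ∷ W) zero    = w
weights ((_ , w) ∷ W) (suc i) = weights W i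

flowAt≡flow : ∀ {v} (W : WeightedBlocks v) x → flowAt (map proj₁ W) (weights W) x ≡ flow W x
flowAt≡flow [] x = refl
flowAt≡flow ((B , w) ∷ W) x rewrite sym (incidence-∈ᵇ x B) | flowAt≡flow W x with x ∈ᵇ B
... | true  = cong (_+ℤ flow W x) (sym (ℤP.*-identityˡ w))
... | false = refl

weights-valid : ∀ {v n} (W : WeightedBlocks v) → All (ValidWeight n ∘ proj₂) W →
                ∀ i → ValidWeight n (weights W i)
weights-valid (_ ∷ W) (ok ∷ _)  zero    = ok
weights-valid (_ ∷ W) (_ ∷ oks) (suc i) = weights-valid W oks i

pairs-++ : ∀ {v} (W W′ : WeightedBlocks v) x y → pairs (W ++ W′) x y ≡ pairs W x y + pairs W′ x y
pairs-++ [] W′ x y = refl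
pairs-++ ((B , _) ∷ W) W′ x y rewrite pairs-++ W W′ x y = sym (+-assoc (incidence x B * incidence y B) _ _)

flow-++ : ∀ {v} (W W′ : WeightedBlocks v) x → flow (W ++ W′) x ≡ flow W x +ℤ flow W′ x
flow-++ [] W′ x = sym (ℤP.+-identityˡ _)
flow-++ ((B , w) ∷ W) W′ x rewrite flow-++ W W′ x = sym (ℤP.+-assoc (+ incidence x B *ℤ w) _ _)

pairs-⋃ : ∀ {v} k (F : Fin k → WeightedBlocks v) x y → pairs (⋃[ i < k ] F i) x y ≡ ∑[ i < k ] pairs (F i) x y
pairs-⋃ zero F x y = refl
pairs-⋃ (suc k) F x y = trans (pairs-++ (F zero) _ x y) (cong (_+_ (pairs (F zero) x y)) (pairs-⋃ k (F ∘ suc) x y))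

flow-⋃ : ∀ {v} k (F : Fin k → WeightedBlocks v) x → flow (⋃[ i < k ] F i) x ≡ ℤΣ.sum (λ i → flow (F i) x)
flow-⋃ zero F x = refl
flow-⋃ (suc k) F x = trans (flow-++ (F zero) _ x) (cong (_+ℤ_ (flow (F zero) x)) (flow-⋃ k (F ∘ suc) x))

valid-⋃ : ∀ {v n} k (F : Fin k → WeightedBlocks v) → (∀ i → All (ValidWeight n ∘ proj₂) (F i)) →
          All (ValidWeight n ∘ proj₂) (⋃[ i < k ] F i)
valid-⋃ k F oks = concat⁺ (tabulate⁺ oks)

weighted : ∀ {v k} → (Fin k → Block v) → (Fin k → ℤ) → WeightedBlocks v
weighted {k = k} B w = ⋃[ i < k ] ((B i , w i) ∷ [])

pairs-weighted : ∀ {v k} (B : Fin k → Block v) w x y →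
  pairs (weighted B w) x y ≡ ∑[ i < k ] (incidence x (B i) * incidence y (B i))
pairs-weighted {k = k} B w x y = trans (pairs-⋃ k _ x y) (sum-cong-≗ {k} λ i → +-identityʳ _)

flow-weighted : ∀ {v k} (B : Fin k → Block v) w x →
  flow (weighted B w) x ≡ ℤΣ.sum (λ i → + incidence x (B i) *ℤ w i)
flow-weighted {k = k} B w x = trans (flow-⋃ k _ x) (ℤΣ.sum-cong-≗ {k} λ i → ℤP.+-identityʳ _)

valid-weighted : ∀ {v k n} (B : Fin k → Block v) w → (∀ i → ValidWeight n (w i)) →
  All (ValidWeight n ∘ proj₂) (weighted B w)
valid-weighted {k = k} B w ok = valid-⋃ k _ (λ i → ok i ∷ [])

flow-weighted-const : ∀ {v k} (B : Fin k → Block v) w x →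
  flow (weighted B (λ _ → w)) x ≡ + (∑[ i < k ] incidence x (B i)) *ℤ w
flow-weighted-const B w x = trans (flow-weighted B _ x) (ℤ∑-scale (λ i → incidence x (B i)) w)

i*1+i*-1≡0 : ∀ i → i *ℤ 1ℤ +ℤ i *ℤ -1ℤ ≡ + 0
i*1+i*-1≡0 i = trans
  (cong₂ _+ℤ_ (ℤP.*-identityʳ i) (trans (sym (ℤP.neg-distribʳ-* i 1ℤ)) (cong ℤ.-_ (ℤP.*-identityʳ i))))
  (ℤP.+-inverseʳ i)

cancelling : ∀ {v k} → (Fin k → Block v) → WeightedBlocks v
cancelling B = weighted B (λ _ → 1ℤ) ++ weighted B (λ _ → -1ℤ)

pairs-cancelling : ∀ {v k} (B : Fin k → Block v) x y →
  pairs (cancelling B) x y ≡ 2 * ∑[ i < k ] (incidence x (B i) * incidence y (B i))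
pairs-cancelling B x y = trans (pairs-++ (weighted B (λ _ → 1ℤ)) _ x y)
  (trans (cong₂ _+_ (pairs-weighted B (λ _ → 1ℤ) x y) (pairs-weighted B (λ _ → -1ℤ) x y))
         (cong (_+_ (∑[ i < _ ] (incidence x (B i) * incidence y (B i)))) (sym (+-identityʳ _))))

flow-cancelling : ∀ {v k} (B : Fin k → Block v) x → flow (cancelling B) x ≡ + 0
flow-cancelling B x = trans (flow-++ (weighted B (λ _ → 1ℤ)) _ x)
  (trans (cong₂ _+ℤ_ (flow-weighted-const B 1ℤ x) (flow-weighted-const B -1ℤ x))
         (i*1+i*-1≡0 (+ ∑[ i < _ ] incidence x (B i))))

valid-cancelling : ∀ {v k n} (B : Fin k → Block v) → 1 < n → All (ValidWeight n ∘ proj₂) (cancelling B)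
valid-cancelling B 1<n =
  ++⁺ (valid-weighted B (λ _ → 1ℤ) (λ _ → (λ ()) , 1<n)) (valid-weighted B (λ _ → -1ℤ) (λ _ → (λ ()) , 1<n))

pairs-sym : ∀ {v} (W : WeightedBlocks v) x y → pairs W x y ≡ pairs W y x
pairs-sym [] x y = refl
pairs-sym ((B , _) ∷ W) x y = cong₂ _+_ (*-comm (incidence x B) (incidence y B)) (pairs-sym W x y)

TS₂WithFlow⇒HasTSWithFlow : ∀ {v n} {W : WeightedBlocks v} → TS₂WithFlow n W → ∀ m → HasTSWithFlow v (m * 2) n
TS₂WithFlow⇒HasTSWithFlow {v} {n} {W} design m =
  map proj₁ W̃ ,
  (λ x y x≢y → begin
    pairCount (map proj₁ W̃) x y ≡⟨ pairCount≡pairs W̃ x y ⟩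
    pairs W̃ x y                ≡⟨ pairs-⋃ m (λ _ → W) x y ⟩
    ∑[ i < m ] pairs W x y     ≡⟨ sum-cong-≗ {m} (λ _ → pairs≡2 x y x≢y) ⟩
    ∑[ i < m ] 2               ≡⟨ ∑-const m 2 ⟩
    m * 2                      ∎) ,
  weights W̃ ,
  weights-valid W̃ (valid-⋃ m (λ _ → W) (λ _ → valid)) ,
  (λ x → trans (flowAt≡flow W̃ x) (trans (flow-⋃ m (λ _ → W) x)
           (trans (ℤΣ.sum-cong-≗ {m} (λ _ → flow≡0 x)) (ℤΣ.sum-replicate-zero m))))
  where
  open TS₂WithFlow design
  open ≡-Reasoning
  W̃ : WeightedBlocks v
  W̃ = ⋃[ _ < m ] W

rangeCount : ℕ → ℕ → ℕ → ℕ
rangeCount c k D = ∑[ i < k ] [ c + toℕ i ≟ℕ D ]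

rangeCount-suc : ∀ c k D → rangeCount c (suc k) D ≡ [ c ≟ℕ D ] + rangeCount (suc c) k D
rangeCount-suc c k D = cong₂ _+_
  (cong (λ e → [ e ≟ℕ D ]) (+-identityʳ c))
  (sum-cong-≗ {k} (λ i → cong (λ e → [ e ≟ℕ D ]) (+-suc c (toℕ i))))

rangeCount-below : ∀ c k D → D < c → rangeCount c k D ≡ 0
rangeCount-below c zero D D<c = refl
rangeCount-below c (suc k) D D<c = begin
  rangeCount c (suc k) D               ≡⟨ rangeCount-suc c k D ⟩
  [ c ≟ℕ D ] + rangeCount (suc c) k D  ≡⟨ cong₂ _+_ ([]-no (c ≟ℕ D) (λ { refl → <-irrefl refl D<c }))
                                                    (rangeCount-below (suc c) k D (m<n⇒m<1+n D<c)) ⟩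
  0                                    ∎
  where open ≡-Reasoning

rangeCount-hit : ∀ c k D → c ≤ D → D < c + k → rangeCount c k D ≡ 1
rangeCount-hit c zero D c≤D D<c+0 = ⊥-elim (<-irrefl refl (<-≤-trans D<c+0 (≤-trans (≤-reflexive (+-identityʳ c)) c≤D)))
rangeCount-hit c (suc k) D c≤D D<c+k with c ≟ℕ D
... | yes refl = trans (rangeCount-suc c k c)
                   (cong₂ _+_ ([]-yes (c ≟ℕ c) refl) (rangeCount-below (suc c) k c (n<1+n c)))
... | no c≢D  = trans (rangeCount-suc c k D) (trans (cong (_+ rangeCount (suc c) k D) ([]-no (c ≟ℕ D) c≢D))
                  (rangeCount-hit (suc c) k D (≤∧≢⇒< c≤D c≢D) (<-≤-trans D<c+k (≤-reflexive (+-suc c k)))))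

rangeCount-++ : ∀ c k l D → rangeCount c (k + l) D ≡ rangeCount c k D + rangeCount (c + k) l D
rangeCount-++ c zero l D = cong (λ c′ → rangeCount c′ l D) (sym (+-identityʳ c))
rangeCount-++ c (suc k) l D = begin
  rangeCount c (suc (k + l)) D
    ≡⟨ rangeCount-suc c (k + l) D ⟩
  [ c ≟ℕ D ] + rangeCount (suc c) (k + l) D
    ≡⟨ cong (_+_ [ c ≟ℕ D ]) (rangeCount-++ (suc c) k l D) ⟩
  [ c ≟ℕ D ] + (rangeCount (suc c) k D + rangeCount (suc c + k) l D)
    ≡⟨ +-assoc [ c ≟ℕ D ] _ _ ⟨
  [ c ≟ℕ D ] + rangeCount (suc c) k D + rangeCount (suc c + k) l D
    ≡⟨ cong₂ _+_ (rangeCount-suc c k D) (cong (λ c′ → rangeCount c′ l D) (+-suc c k)) ⟨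
  rangeCount c (suc k) D + rangeCount (c + suc k) l D ∎
  where open ≡-Reasoning

rangeCount-merge : ∀ c k l D {c′} → c + k ≡ c′ → rangeCount c k D + rangeCount c′ l D ≡ rangeCount c (k + l) D
rangeCount-merge c k l D refl = sym (rangeCount-++ c k l D)

rangeCount-merge₃ : ∀ c k l m D {c′ c″} → c + k ≡ c′ → c′ + l ≡ c″ →
  rangeCount c k D + rangeCount c′ l D + rangeCount c″ m D ≡ rangeCount c (k + l + m) D
rangeCount-merge₃ c k l m D refl refl = trans
  (cong (_+ rangeCount (c + k + l) m D) (rangeCount-merge c k l D refl))
  (rangeCount-merge c (k + l) m D (sym (+-assoc c k l)))

rangeCount-pairs : ∀ c k D →
  ∑[ i < k ] ([ c + 2 * toℕ i ≟ℕ D ] + [ suc (c + 2 * toℕ i) ≟ℕ D ]) ≡ rangeCount c (k + k) D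
rangeCount-pairs c zero D = refl
rangeCount-pairs c (suc k) D = begin
  [ c + 0 ≟ℕ D ] + [ suc (c + 0) ≟ℕ D ]
    + ∑[ i < k ] ([ c + 2 * suc (toℕ i) ≟ℕ D ] + [ suc (c + 2 * suc (toℕ i)) ≟ℕ D ])
      ≡⟨ cong₂ _+_ (cong₂ _+_ (cong (λ e → [ e ≟ℕ D ]) (+-identityʳ c)) (cong (λ e → [ suc e ≟ℕ D ]) (+-identityʳ c)))
                   (sum-cong-≗ {k} λ i → cong (λ e → [ e ≟ℕ D ] + [ suc e ≟ℕ D ]) (shift (toℕ i))) ⟩
  [ c ≟ℕ D ] + [ suc c ≟ℕ D ] + ∑[ i < k ] ([ 2 + c + 2 * toℕ i ≟ℕ D ] + [ suc (2 + c + 2 * toℕ i) ≟ℕ D ])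
      ≡⟨ cong (_+_ ([ c ≟ℕ D ] + [ suc c ≟ℕ D ])) (rangeCount-pairs (2 + c) k D) ⟩
  [ c ≟ℕ D ] + [ suc c ≟ℕ D ] + rangeCount (2 + c) (k + k) D
      ≡⟨ +-assoc [ c ≟ℕ D ] _ _ ⟩
  [ c ≟ℕ D ] + ([ suc c ≟ℕ D ] + rangeCount (2 + c) (k + k) D)
      ≡⟨ cong (_+_ [ c ≟ℕ D ]) (rangeCount-suc (suc c) (k + k) D) ⟨
  [ c ≟ℕ D ] + rangeCount (suc c) (suc (k + k)) D
      ≡⟨ rangeCount-suc c (suc (k + k)) D ⟨
  rangeCount c (suc (suc (k + k))) D
      ≡⟨ cong (λ m → rangeCount c (suc m) D) (+-suc k k) ⟨
  rangeCount c (suc k + suc k) D ∎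
  where
  open ≡-Reasoning
  shift : ∀ i → c + 2 * suc i ≡ 2 + c + 2 * i
  shift = solve-∀

∑-snoc : ∀ k (g : ℕ → ℕ) → ∑[ i < suc k ] g (toℕ i) ≡ ∑[ i < k ] g (toℕ i) + g k
∑-snoc zero g = +-identityʳ (g 0)
∑-snoc (suc k) g = trans (cong (_+_ (g 0)) (∑-snoc k (g ∘ suc))) (sym (+-assoc (g 0) _ _))

∑-reverse : ∀ k (g : ℕ → ℕ) → ∑[ i < k ] g (k ∸ suc (toℕ i)) ≡ ∑[ i < k ] g (toℕ i)
∑-reverse zero g = refl
∑-reverse (suc k) g = begin
  g k + ∑[ i < k ] g (k ∸ suc (toℕ i)) ≡⟨ cong (_+_ (g k)) (∑-reverse k g) ⟩
  g k + ∑[ i < k ] g (toℕ i)           ≡⟨ +-comm (g k) _ ⟩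
  ∑[ i < k ] g (toℕ i) + g k           ≡⟨ ∑-snoc k g ⟨
  ∑[ i < suc k ] g (toℕ i)             ∎
  where open ≡-Reasoning

-- Translation in ℤ/nℤ

[m%n+k]%n≡[m+k]%n : ∀ m k n .{{_ : NonZero n}} → (m % n + k) % n ≡ (m + k) % n
[m%n+k]%n≡[m+k]%n m k n = begin
  (m % n + k) % n         ≡⟨ %-distribˡ-+ (m % n) k n ⟩
  (m % n % n + k % n) % n ≡⟨ cong (λ r → (r + k % n) % n) (m%n%n≡m%n m n) ⟩
  (m % n + k % n) % n     ≡⟨ %-distribˡ-+ m k n ⟨
  (m + k) % n             ∎
  where open ≡-Reasoning

module Cyclic (n : ℕ) .{{_ : NonZero n}} where

  infixl 6 _⊕_

  _⊕_ : Fin n → ℕ → Fin n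
  x ⊕ k = fromℕ< (m%n<n (toℕ x + k) n)

  toℕ-⊕ : ∀ x k → toℕ (x ⊕ k) ≡ (toℕ x + k) % n
  toℕ-⊕ x k = FinP.toℕ-fromℕ< _

  ⊕-assoc : ∀ x a b → x ⊕ a ⊕ b ≡ x ⊕ (a + b)
  ⊕-assoc x a b = FinP.toℕ-injective (begin
    toℕ (x ⊕ a ⊕ b)           ≡⟨ toℕ-⊕ (x ⊕ a) b ⟩
    (toℕ (x ⊕ a) + b) % n     ≡⟨ cong (λ r → (r + b) % n) (toℕ-⊕ x a) ⟩
    ((toℕ x + a) % n + b) % n ≡⟨ [m%n+k]%n≡[m+k]%n (toℕ x + a) b n ⟩
    (toℕ x + a + b) % n       ≡⟨ cong (_% n) (+-assoc (toℕ x) a b) ⟩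
    (toℕ x + (a + b)) % n     ≡⟨ toℕ-⊕ x (a + b) ⟨
    toℕ (x ⊕ (a + b))         ∎)
    where open ≡-Reasoning

  ⊕-n : ∀ x → x ⊕ n ≡ x
  ⊕-n x = FinP.toℕ-injective (trans (toℕ-⊕ x n) (trans ([m+n]%n≡m%n (toℕ x) n) (m<n⇒m%n≡m (FinP.toℕ<n x))))

  ⊕-0 : ∀ x → x ⊕ 0 ≡ x
  ⊕-0 x = FinP.toℕ-injective
    (trans (toℕ-⊕ x 0) (trans (cong (_% n) (+-identityʳ (toℕ x))) (m<n⇒m%n≡m (FinP.toℕ<n x))))

  ⊕-n+ : ∀ x e → x ⊕ (n + e) ≡ x ⊕ e
  ⊕-n+ x e = trans (sym (⊕-assoc x n e)) (cong (_⊕ e) (⊕-n x))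

  ⊕≡⇔≡⊕[n∸] : ∀ {s x a} → a ≤ n → (s ⊕ a ≡ x ⇔ s ≡ x ⊕ (n ∸ a))
  ⊕≡⇔≡⊕[n∸] {s} {x} {a} a≤n = mk⇔
    (λ { refl → sym (trans (⊕-assoc s a (n ∸ a)) (trans (cong (s ⊕_) (m+[n∸m]≡n a≤n)) (⊕-n s))) })
    (λ { refl → trans (⊕-assoc x (n ∸ a) a) (trans (cong (x ⊕_) (m∸n+n≡m a≤n)) (⊕-n x)) })

  ∑-translate : ∀ x a → a ≤ n → (h : Fin n → ℕ) → ∑[ s < n ] ([ x ≟ s ⊕ a ] * h s) ≡ h (x ⊕ (n ∸ a))
  ∑-translate x a a≤n h = trans (sum-cong-≗ {n} λ s → cong (_* h s) (indicator-swap s)) (∑-select (x ⊕ (n ∸ a)) h)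
    where
    indicator-swap : ∀ s → [ x ≟ s ⊕ a ] ≡ [ s ≟ x ⊕ (n ∸ a) ]
    indicator-swap s = []-⇔ (mk⇔ (to ∘ sym) (sym ∘ from)) (x ≟ s ⊕ a) (s ≟ x ⊕ (n ∸ a))
      where open Function.Equivalence (⊕≡⇔≡⊕[n∸] {s} {x} a≤n)

  diff : Fin n → Fin n → ℕ
  diff x y = toℕ (y ⊕ (n ∸ toℕ x))

  ⊕-diff : ∀ x y → x ⊕ diff x y ≡ y
  ⊕-diff x y = FinP.toℕ-injective (begin
    toℕ (x ⊕ diff x y)                        ≡⟨ toℕ-⊕ x (diff x y) ⟩
    (toℕ x + diff x y) % n                    ≡⟨ cong (λ r → (toℕ x + r) % n) (toℕ-⊕ y (n ∸ toℕ x)) ⟩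
    (toℕ x + (toℕ y + (n ∸ toℕ x)) % n) % n   ≡⟨ cong (_% n) (+-comm (toℕ x) _) ⟩
    ((toℕ y + (n ∸ toℕ x)) % n + toℕ x) % n   ≡⟨ [m%n+k]%n≡[m+k]%n (toℕ y + (n ∸ toℕ x)) (toℕ x) n ⟩
    (toℕ y + (n ∸ toℕ x) + toℕ x) % n         ≡⟨ cong (_% n) (+-assoc (toℕ y) _ _) ⟩
    (toℕ y + (n ∸ toℕ x + toℕ x)) % n         ≡⟨ cong (λ r → (toℕ y + r) % n) (m∸n+n≡m (<⇒≤ (FinP.toℕ<n x))) ⟩
    (toℕ y + n) % n                           ≡⟨ [m+n]%n≡m%n (toℕ y) n ⟩
    toℕ y % n                                 ≡⟨ m<n⇒m%n≡m (FinP.toℕ<n y) ⟩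
    toℕ y                                     ∎)
    where open ≡-Reasoning

  diff-⊕ : ∀ x e → e < n → diff x (x ⊕ e) ≡ e
  diff-⊕ x e e<n = begin
    toℕ (x ⊕ e ⊕ (n ∸ toℕ x))          ≡⟨ cong toℕ (⊕-assoc x e (n ∸ toℕ x)) ⟩
    toℕ (x ⊕ (e + (n ∸ toℕ x)))        ≡⟨ toℕ-⊕ x _ ⟩
    (toℕ x + (e + (n ∸ toℕ x))) % n    ≡⟨ cong (_% n) (+-comm (toℕ x) _) ⟩
    (e + (n ∸ toℕ x) + toℕ x) % n      ≡⟨ cong (_% n) (+-assoc e _ _) ⟩
    (e + (n ∸ toℕ x + toℕ x)) % n      ≡⟨ cong (λ r → (e + r) % n) (m∸n+n≡m (<⇒≤ (FinP.toℕ<n x))) ⟩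
    (e + n) % n                        ≡⟨ [m+n]%n≡m%n e n ⟩
    e % n                              ≡⟨ m<n⇒m%n≡m e<n ⟩
    e                                  ∎
    where open ≡-Reasoning

  diff<n : ∀ x y → diff x y < n
  diff<n x y = FinP.toℕ<n _

  diff≢0 : ∀ {x y} → x ≢ y → diff x y ≢ 0
  diff≢0 {x} {y} x≢y d≡0 = x≢y (trans (sym (⊕-0 x)) (trans (cong (x ⊕_) (sym d≡0)) (⊕-diff x y)))

  [≟⊕]≡[≟diff] : ∀ x y {m} e → x ⊕ m ≡ x ⊕ e → e < n → [ y ≟ x ⊕ m ] ≡ [ e ≟ℕ diff x y ]
  [≟⊕]≡[≟diff] x y e eq e<n = trans (cong (λ z → [ y ≟ z ]) eq) ([]-⇔
    (mk⇔ (λ { refl → sym (diff-⊕ x e e<n) }) (λ { refl → sym (⊕-diff x y) }))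
    (y ≟ x ⊕ e) (e ≟ℕ diff x y))

  diff-self : ∀ x → diff x x ≡ 0
  diff-self x = trans (cong (diff x) (sym (⊕-0 x))) (diff-⊕ x 0 (≤-<-trans z≤n (FinP.toℕ<n x)))

  ⊕-∸+ : ∀ x {a} → a ≤ n → x ⊕ (n ∸ a + a) ≡ x
  ⊕-∸+ x a≤n = trans (cong (x ⊕_) (m∸n+n≡m a≤n)) (⊕-n x)

  [≟⊕∸+]≡0 : ∀ {x y} → x ≢ y → ∀ a → a ≤ n → [ y ≟ x ⊕ (n ∸ a + a) ] ≡ 0
  [≟⊕∸+]≡0 {x} {y} x≢y a a≤n = []-no (y ≟ _) λ eq → x≢y (sym (trans eq (⊕-∸+ x a≤n)))

  ∑-translates : ∀ {k} (o : Fin k → ℕ) → (∀ i → o i ≤ n) → (a b : Fin k → ℕ) (x y : Fin n) →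
    ∑[ s < n ] ((∑[ i < k ] ([ x ≟ s ⊕ o i ] * a i)) * (∑[ j < k ] ([ y ≟ s ⊕ o j ] * b j)))
    ≡ ∑[ i < k ] ∑[ j < k ] ([ y ≟ x ⊕ (n ∸ o i + o j) ] * (a i * b j))
  ∑-translates {k} o o≤n a b x y = begin
    ∑[ s < n ] ((∑[ i < k ] X s i) * (∑[ j < k ] Y s j)) ≡⟨ sum-cong-≗ {n} (λ s → ∑*∑ (X s) (Y s)) ⟩
    ∑[ s < n ] ∑[ i < k ] ∑[ j < k ] (X s i * Y s j)     ≡⟨ ∑-comm (λ s i → ∑[ j < k ] (X s i * Y s j)) ⟩
    ∑[ i < k ] ∑[ s < n ] ∑[ j < k ] (X s i * Y s j)     ≡⟨ sum-cong-≗ {k} (λ i → ∑-comm (λ s j → X s i * Y s j)) ⟩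
    ∑[ i < k ] ∑[ j < k ] ∑[ s < n ] (X s i * Y s j)     ≡⟨ sum-cong-≗ {k} (λ i → sum-cong-≗ {k} (λ j → orbit i j)) ⟩
    ∑[ i < k ] ∑[ j < k ] ([ y ≟ x ⊕ (n ∸ o i + o j) ] * (a i * b j)) ∎
    where
    open ≡-Reasoning
    X Y : Fin n → Fin k → ℕ
    X s i = [ x ≟ s ⊕ o i ] * a i
    Y s j = [ y ≟ s ⊕ o j ] * b j
    reassociate : ∀ p a q b → (p * a) * (q * b) ≡ p * (q * (a * b))
    reassociate = solve-∀
    orbit : ∀ i j → ∑[ s < n ] (X s i * Y s j) ≡ [ y ≟ x ⊕ (n ∸ o i + o j) ] * (a i * b j)
    orbit i j = begin
      ∑[ s < n ] (X s i * Y s j)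
        ≡⟨ sum-cong-≗ {n} (λ s → reassociate ([ x ≟ s ⊕ o i ]) (a i) ([ y ≟ s ⊕ o j ]) (b j)) ⟩
      ∑[ s < n ] ([ x ≟ s ⊕ o i ] * ([ y ≟ s ⊕ o j ] * (a i * b j)))
        ≡⟨ ∑-translate x (o i) (o≤n i) (λ s → [ y ≟ s ⊕ o j ] * (a i * b j)) ⟩
      [ y ≟ x ⊕ (n ∸ o i) ⊕ o j ] * (a i * b j)
        ≡⟨ cong (λ z → [ y ≟ z ] * (a i * b j)) (⊕-assoc x (n ∸ o i) (o j)) ⟩
      [ y ≟ x ⊕ (n ∸ o i + o j) ] * (a i * b j) ∎

  ⊕-injective : ∀ s {a b} → a < n → b < n → s ⊕ a ≡ s ⊕ b → a ≡ b
  ⊕-injective s {a} {b} a<n b<n eq = trans (sym (diff-⊕ s a a<n)) (trans (cong (diff s) eq) (diff-⊕ s b b<n))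

  triangle : Fin n → (p q : ℕ) → 0 < p → p < q → q < n → Block n
  triangle s p q 0<p p<q q<n = block (s ⊕ 0) (s ⊕ p) (s ⊕ q)
    (λ eq → <-irrefl (⊕-injective s 0<n p<n eq) 0<p)
    (λ eq → <-irrefl (⊕-injective s 0<n q<n eq) (<-trans 0<p p<q))
    (λ eq → <-irrefl (⊕-injective s p<n q<n eq) p<q)
    where
    p<n : p < n
    p<n = <-trans p<q q<n
    0<n : 0 < n
    0<n = <-trans 0<p p<n

  offsets : ℕ → ℕ → Fin 3 → ℕ
  offsets p q 0F = 0
  offsets p q 1F = p
  offsets p q 2F = q

  -- The multiplicity of D among the representatives of ±p, ±q and ±(q − p).
  differences : ℕ → ℕ → ℕ → ℕ
  differences p q D =
    [ p ≟ℕ D ] + [ q ≟ℕ D ] + [ q ∸ p ≟ℕ D ] + [ n ∸ p ≟ℕ D ] + [ n ∸ q ≟ℕ D ] + [ n ∸ q + p ≟ℕ D ]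

  module _ {p q : ℕ} (0<p : 0 < p) (p<q : p < q) (q<n : q < n) where

    private
      T : Fin n → Block n
      T s = triangle s p q 0<p p<q q<n
      o≤n : ∀ i → offsets p q i ≤ n
      o≤n 0F = z≤n
      o≤n 1F = <⇒≤ (<-trans p<q q<n)
      o≤n 2F = <⇒≤ q<n

    incidence-triangle : ∀ x s → incidence x (T s) ≡ ∑[ i < 3 ] ([ x ≟ s ⊕ offsets p q i ] * 1)
    incidence-triangle x s = as-sum [ x ≟ s ⊕ 0 ] [ x ≟ s ⊕ p ] [ x ≟ s ⊕ q ]
      where
      as-sum : ∀ a b c → a + b + c ≡ a * 1 + (b * 1 + (c * 1 + 0))
      as-sum = solve-∀

    ∑-incidence-triangle : ∀ x → ∑[ s < n ] incidence x (T s) ≡ 3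
    ∑-incidence-triangle x = begin
      ∑[ s < n ] incidence x (T s)                              ≡⟨ sum-cong-≗ {n} (incidence-triangle x) ⟩
      ∑[ s < n ] ∑[ i < 3 ] ([ x ≟ s ⊕ offsets p q i ] * 1)     ≡⟨ ∑-comm (λ s i → [ x ≟ s ⊕ offsets p q i ] * 1) ⟩
      ∑[ i < 3 ] ∑[ s < n ] ([ x ≟ s ⊕ offsets p q i ] * 1)     ≡⟨ sum-cong-≗ {3} (λ i → ∑-translate x _ (o≤n i) (λ _ → 1)) ⟩
      3                                                         ∎
      where open ≡-Reasoning

    ∑-pairs-triangle : ∀ {x y} → x ≢ y →
      ∑[ s < n ] (incidence x (T s) * incidence y (T s)) ≡ differences p q (diff x y)
    ∑-pairs-triangle {x} {y} x≢y = begin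
      ∑[ s < n ] (incidence x (T s) * incidence y (T s))
        ≡⟨ sum-cong-≗ {n} (λ s → cong₂ _*_ (incidence-triangle x s) (incidence-triangle y s)) ⟩
      ∑[ s < n ] ((∑[ i < 3 ] ([ x ≟ s ⊕ o i ] * 1)) * (∑[ j < 3 ] ([ y ≟ s ⊕ o j ] * 1)))
        ≡⟨ ∑-translates o o≤n (λ _ → 1) (λ _ → 1) x y ⟩
      ∑[ i < 3 ] ∑[ j < 3 ] ([ y ≟ x ⊕ (n ∸ o i + o j) ] * (1 * 1))
        ≡⟨ ∑₃∑₃ (λ i j → [ y ≟ x ⊕ (n ∸ o i + o j) ] * (1 * 1)) ⟩
      _ ≡⟨ cong₂ _+_ (cong₂ _+_ (cong₂ _+_ (diagonal 0 z≤n) (diagonal p p≤n)) (diagonal q (<⇒≤ q<n)))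
           (cong₂ _+_ (cong₂ _+_ (cong₂ _+_ (cong₂ _+_ (cong₂ _+_
             (term p (⊕-n+ x p) p<n)
             (term q (⊕-n+ x q) q<n))
             (term (q ∸ p) (trans (cong (x ⊕_) n∸p+q≡n+[q∸p]) (⊕-n+ x (q ∸ p))) (≤-<-trans (m∸n≤m q p) q<n)))
             (term (n ∸ p) (cong (x ⊕_) (+-identityʳ (n ∸ p))) (∸-monoʳ-< 0<p p≤n)))
             (term (n ∸ q) (cong (x ⊕_) (+-identityʳ (n ∸ q))) (∸-monoʳ-< (<-trans 0<p p<q) (<⇒≤ q<n))))
             (term (n ∸ q + p) refl (<-≤-trans (+-monoʳ-< (n ∸ q) p<q) (≤-reflexive (m∸n+n≡m (<⇒≤ q<n)))))) ⟩
      differences p q (diff x y) ∎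
      where
      open ≡-Reasoning
      o : Fin 3 → ℕ
      o = offsets p q
      p<n : p < n
      p<n = <-trans p<q q<n
      p≤n : p ≤ n
      p≤n = <⇒≤ p<n
      n∸p+q≡n+[q∸p] : n ∸ p + q ≡ n + (q ∸ p)
      n∸p+q≡n+[q∸p] = begin
        n ∸ p + q             ≡⟨ cong (_+_ (n ∸ p)) (m+[n∸m]≡n (<⇒≤ p<q)) ⟨
        n ∸ p + (p + (q ∸ p)) ≡⟨ +-assoc (n ∸ p) p (q ∸ p) ⟨
        n ∸ p + p + (q ∸ p)   ≡⟨ cong (_+ (q ∸ p)) (m∸n+n≡m p≤n) ⟩
        n + (q ∸ p)           ∎
      diagonal : ∀ a → a ≤ n → [ y ≟ x ⊕ (n ∸ a + a) ] * (1 * 1) ≡ 0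
      diagonal a a≤n = trans (*-identityʳ _) ([≟⊕∸+]≡0 x≢y a a≤n)
      term : ∀ {m} e → x ⊕ m ≡ x ⊕ e → e < n → [ y ≟ x ⊕ m ] * (1 * 1) ≡ [ e ≟ℕ diff x y ]
      term e eq e<n = trans (*-identityʳ _) ([≟⊕]≡[≟diff] x y e eq e<n)

-- Part (b): a 2-fold difference family in ℤ/(6t + 1)ℤ

o∸m≡n : ∀ m n {o} → m + n ≡ o → o ∸ m ≡ n
o∸m≡n m n refl = m+n∸m≡n m n

+₃₃-cong : ∀ {a₁ a₂ a₃ a₄ a₅ a₆ b₁ b₂ b₃ b₄ b₅ b₆ : ℕ} →
           a₁ ≡ b₁ → a₂ ≡ b₂ → a₃ ≡ b₃ → a₄ ≡ b₄ → a₅ ≡ b₅ → a₆ ≡ b₆ →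
           a₁ + a₂ + a₃ + a₄ + a₅ + a₆ ≡ (b₁ + b₂ + b₃) + (b₄ + b₅ + b₆)
+₃₃-cong {a₁} {a₂} {a₃} {a₄} {a₅} {a₆} refl refl refl refl refl refl = regroup a₁ a₂ a₃ a₄ a₅ a₆
  where
  regroup : ∀ a₁ a₂ a₃ a₄ a₅ a₆ → a₁ + a₂ + a₃ + a₄ + a₅ + a₆ ≡ (a₁ + a₂ + a₃) + (a₄ + a₅ + a₆)
  regroup = solve-∀

module DifferenceFamily (t D : ℕ) where

  open Cyclic (suc (6 * t)) using (differences)

  [_]D : ℕ → ℕ
  [ e ]D = [ e ≟ℕ D ]

  -- The differences of the two base triangles with a = j + 1 split into those increasing in j (F)
  -- and those decreasing in j, written in terms of r = t − 1 − j (B). After reindexing they tile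
  -- [1, 6t] twice: by the six intervals of length t, and by [1, t], [t + 1, 3t] (odd and even
  -- offsets), [3t + 1, 5t] (likewise) and [5t + 1, 6t].
  F₁ F₂ B₁ B₂ tiling₁ tiling₂ : ℕ → ℕ
  F₁ j = [ 1 + j ]D + [ suc (1 + t + 2 * j) ]D + [ 1 + t + j ]D
  F₂ j = [ 1 + j ]D + [ suc (1 + 3 * t + 2 * j) ]D + [ 1 + 3 * t + j ]D
  B₁ r = [ 1 + 5 * t + r ]D + [ 1 + 3 * t + 2 * r ]D + [ 1 + 4 * t + r ]D
  B₂ r = [ 1 + 5 * t + r ]D + [ 1 + t + 2 * r ]D + [ 1 + 2 * t + r ]D
  tiling₁ i = [ 1 + i ]D + [ 1 + t + i ]D + [ 1 + 2 * t + i ]D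
              + ([ 1 + 3 * t + i ]D + [ 1 + 4 * t + i ]D + [ 1 + 5 * t + i ]D)
  tiling₂ i = [ 1 + i ]D + ([ 1 + t + 2 * i ]D + [ suc (1 + t + 2 * i) ]D)
              + ([ 1 + 3 * t + 2 * i ]D + [ suc (1 + 3 * t + 2 * i) ]D) + [ 1 + 5 * t + i ]D

  differences₁ : ∀ j r → t ≡ suc (j + r) → differences (suc j) (2 * suc j + t) D ≡ F₁ j + B₁ r
  differences₁ j r refl = +₃₃-cong
    refl
    (cong [_]D (q≡ j r))
    (cong [_]D (o∸m≡n (suc j) _ (q∸p≡ j r)))
    (cong [_]D (o∸m≡n (suc j) _ (n∸p≡ j r)))
    (cong [_]D n∸q)
    (cong [_]D (trans (cong (_+ suc j) n∸q) (n∸q+p≡ j r)))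
    where
    q≡ : ∀ j r → 2 * suc j + suc (j + r) ≡ suc (1 + suc (j + r) + 2 * j)
    q≡ = solve-∀
    q∸p≡ : ∀ j r → suc j + (1 + suc (j + r) + j) ≡ 2 * suc j + suc (j + r)
    q∸p≡ = solve-∀
    n∸p≡ : ∀ j r → suc j + (1 + 5 * suc (j + r) + r) ≡ suc (6 * suc (j + r))
    n∸p≡ = solve-∀
    n∸q≡ : ∀ j r → 2 * suc j + suc (j + r) + (1 + 3 * suc (j + r) + 2 * r) ≡ suc (6 * suc (j + r))
    n∸q≡ = solve-∀
    n∸q+p≡ : ∀ j r → 1 + 3 * suc (j + r) + 2 * r + suc j ≡ 1 + 4 * suc (j + r) + r
    n∸q+p≡ = solve-∀
    n∸q : suc (6 * suc (j + r)) ∸ (2 * suc j + suc (j + r)) ≡ 1 + 3 * suc (j + r) + 2 * r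
    n∸q = o∸m≡n (2 * suc j + suc (j + r)) _ (n∸q≡ j r)

  differences₂ : ∀ j r → t ≡ suc (j + r) → differences (suc j) (2 * suc j + 3 * t) D ≡ F₂ j + B₂ r
  differences₂ j r refl = +₃₃-cong
    refl
    (cong [_]D (q≡ j r))
    (cong [_]D (o∸m≡n (suc j) _ (q∸p≡ j r)))
    (cong [_]D (o∸m≡n (suc j) _ (n∸p≡ j r)))
    (cong [_]D n∸q)
    (cong [_]D (trans (cong (_+ suc j) n∸q) (n∸q+p≡ j r)))
    where
    q≡ : ∀ j r → 2 * suc j + 3 * suc (j + r) ≡ suc (1 + 3 * suc (j + r) + 2 * j)
    q≡ = solve-∀
    q∸p≡ : ∀ j r → suc j + (1 + 3 * suc (j + r) + j) ≡ 2 * suc j + 3 * suc (j + r)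
    q∸p≡ = solve-∀
    n∸p≡ : ∀ j r → suc j + (1 + 5 * suc (j + r) + r) ≡ suc (6 * suc (j + r))
    n∸p≡ = solve-∀
    n∸q≡ : ∀ j r → 2 * suc j + 3 * suc (j + r) + (1 + suc (j + r) + 2 * r) ≡ suc (6 * suc (j + r))
    n∸q≡ = solve-∀
    n∸q+p≡ : ∀ j r → 1 + suc (j + r) + 2 * r + suc j ≡ 1 + 2 * suc (j + r) + r
    n∸q+p≡ = solve-∀
    n∸q : suc (6 * suc (j + r)) ∸ (2 * suc j + 3 * suc (j + r)) ≡ 1 + suc (j + r) + 2 * r
    n∸q = o∸m≡n (2 * suc j + 3 * suc (j + r)) _ (n∸q≡ j r)

  retile : ∀ i → F₁ i + F₂ i + (B₁ i + B₂ i) ≡ tiling₁ i + tiling₂ i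
  retile i = regroup [ 1 + i ]D [ 1 + t + i ]D [ 1 + 3 * t + i ]D [ 1 + 3 * t + 2 * i ]D [ 1 + 5 * t + i ]D
                     [ 1 + 4 * t + i ]D [ suc (1 + t + 2 * i) ]D [ suc (1 + 3 * t + 2 * i) ]D [ 1 + t + 2 * i ]D [ 1 + 2 * t + i ]D
    where
    regroup : ∀ a b c d e f g h k l →
      a + g + b + (a + h + c) + (e + d + f + (e + k + l)) ≡ a + b + l + (c + f + e) + (a + (k + g) + (d + h) + e)
    regroup = solve-∀

  module _ (1≤D : 1 ≤ D) (D≤6t : D ≤ 6 * t) where

    private
      covers : ∀ {k} → k ≡ 6 * t → rangeCount 1 k D ≡ 1
      covers refl = rangeCount-hit 1 (6 * t) D 1≤D (s≤s D≤6t)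

    tiling₁-count : ∑[ i < t ] tiling₁ (toℕ i) ≡ 1
    tiling₁-count = begin
      ∑[ i < t ] tiling₁ (toℕ i)
        ≡⟨ ∑-distrib-+ {t} _ _ ⟩
      ∑[ i < t ] ([ 1 + toℕ i ]D + [ 1 + t + toℕ i ]D + [ 1 + 2 * t + toℕ i ]D)
        + ∑[ i < t ] ([ 1 + 3 * t + toℕ i ]D + [ 1 + 4 * t + toℕ i ]D + [ 1 + 5 * t + toℕ i ]D)
        ≡⟨ cong₂ _+_ (∑-distrib-+₃ {t} _ _ _) (∑-distrib-+₃ {t} _ _ _) ⟩
      rangeCount 1 t D + rangeCount (1 + t) t D + rangeCount (1 + 2 * t) t D
        + (rangeCount (1 + 3 * t) t D + rangeCount (1 + 4 * t) t D + rangeCount (1 + 5 * t) t D)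
        ≡⟨ cong₂ _+_ (rangeCount-merge₃ 1 t t t D refl (e₁ t)) (rangeCount-merge₃ (1 + 3 * t) t t t D (e₂ t) (e₃ t)) ⟩
      rangeCount 1 (t + t + t) D + rangeCount (1 + 3 * t) (t + t + t) D
        ≡⟨ rangeCount-merge 1 (t + t + t) (t + t + t) D (e₄ t) ⟩
      rangeCount 1 (t + t + t + (t + t + t)) D
        ≡⟨ covers (e₅ t) ⟩
      1 ∎
      where
      open ≡-Reasoning
      e₁ : ∀ t → 1 + t + t ≡ 1 + 2 * t
      e₁ = solve-∀
      e₂ : ∀ t → 1 + 3 * t + t ≡ 1 + 4 * t
      e₂ = solve-∀
      e₃ : ∀ t → 1 + 4 * t + t ≡ 1 + 5 * t
      e₃ = solve-∀
      e₄ : ∀ t → 1 + (t + t + t) ≡ 1 + 3 * t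
      e₄ = solve-∀
      e₅ : ∀ t → t + t + t + (t + t + t) ≡ 6 * t
      e₅ = solve-∀

    tiling₂-count : ∑[ i < t ] tiling₂ (toℕ i) ≡ 1
    tiling₂-count = begin
      ∑[ i < t ] tiling₂ (toℕ i)
        ≡⟨ ∑-distrib-+ {t} _ _ ⟩
      ∑[ i < t ] ([ 1 + toℕ i ]D + ([ 1 + t + 2 * toℕ i ]D + [ suc (1 + t + 2 * toℕ i) ]D)
                   + ([ 1 + 3 * t + 2 * toℕ i ]D + [ suc (1 + 3 * t + 2 * toℕ i) ]D))
        + rangeCount (1 + 5 * t) t D
        ≡⟨ cong (_+ rangeCount (1 + 5 * t) t D) (∑-distrib-+₃ {t} _ _ _) ⟩
      rangeCount 1 t D
        + ∑[ i < t ] ([ 1 + t + 2 * toℕ i ]D + [ suc (1 + t + 2 * toℕ i) ]D)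
        + ∑[ i < t ] ([ 1 + 3 * t + 2 * toℕ i ]D + [ suc (1 + 3 * t + 2 * toℕ i) ]D)
        + rangeCount (1 + 5 * t) t D
        ≡⟨ cong (λ m → m + rangeCount (1 + 5 * t) t D)
             (cong₂ _+_ (cong (_+_ (rangeCount 1 t D)) (rangeCount-pairs (1 + t) t D)) (rangeCount-pairs (1 + 3 * t) t D)) ⟩
      rangeCount 1 t D + rangeCount (1 + t) (t + t) D + rangeCount (1 + 3 * t) (t + t) D + rangeCount (1 + 5 * t) t D
        ≡⟨ cong (_+ rangeCount (1 + 5 * t) t D) (rangeCount-merge₃ 1 t (t + t) (t + t) D refl (e₁ t)) ⟩
      rangeCount 1 (t + (t + t) + (t + t)) D + rangeCount (1 + 5 * t) t D
        ≡⟨ rangeCount-merge 1 (t + (t + t) + (t + t)) t D (e₂ t) ⟩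
      rangeCount 1 (t + (t + t) + (t + t) + t) D
        ≡⟨ covers (e₃ t) ⟩
      1 ∎
      where
      open ≡-Reasoning
      e₁ : ∀ t → 1 + t + (t + t) ≡ 1 + 3 * t
      e₁ = solve-∀
      e₂ : ∀ t → 1 + (t + (t + t) + (t + t)) ≡ 1 + 5 * t
      e₂ = solve-∀
      e₃ : ∀ t → t + (t + t) + (t + t) + t ≡ 6 * t
      e₃ = solve-∀

    ∑-differences : ∑[ j < t ] (differences (suc (toℕ j)) (2 * suc (toℕ j) + t) D
                                + differences (suc (toℕ j)) (2 * suc (toℕ j) + 3 * t) D) ≡ 2
    ∑-differences = begin
      ∑[ j < t ] (differences (suc (toℕ j)) (2 * suc (toℕ j) + t) D
                  + differences (suc (toℕ j)) (2 * suc (toℕ j) + 3 * t) D)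
        ≡⟨ sum-cong-≗ {t} (λ j → split (toℕ j) (t ∸ suc (toℕ j)) (sym (m+[n∸m]≡n (FinP.toℕ<n j)))) ⟩
      ∑[ j < t ] (F (toℕ j) + B (t ∸ suc (toℕ j)))
        ≡⟨ ∑-distrib-+ {t} _ _ ⟩
      ∑[ j < t ] F (toℕ j) + ∑[ j < t ] B (t ∸ suc (toℕ j))
        ≡⟨ cong (_+_ (∑[ j < t ] F (toℕ j))) (∑-reverse t B) ⟩
      ∑[ j < t ] F (toℕ j) + ∑[ j < t ] B (toℕ j)
        ≡⟨ ∑-distrib-+ {t} _ _ ⟨
      ∑[ i < t ] (F (toℕ i) + B (toℕ i))
        ≡⟨ sum-cong-≗ {t} (λ i → retile (toℕ i)) ⟩
      ∑[ i < t ] (tiling₁ (toℕ i) + tiling₂ (toℕ i))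
        ≡⟨ ∑-distrib-+ {t} _ _ ⟩
      ∑[ i < t ] tiling₁ (toℕ i) + ∑[ i < t ] tiling₂ (toℕ i)
        ≡⟨ cong₂ _+_ tiling₁-count tiling₂-count ⟩
      2 ∎
      where
      open ≡-Reasoning
      F B : ℕ → ℕ
      F j = F₁ j + F₂ j
      B r = B₁ r + B₂ r
      split : ∀ j r → t ≡ suc (j + r) →
        differences (suc j) (2 * suc j + t) D + differences (suc j) (2 * suc j + 3 * t) D ≡ F j + B r
      split j r eq = trans (cong₂ _+_ (differences₁ j r eq) (differences₂ j r eq))
                           (interchange (F₁ j) (B₁ r) (F₂ j) (B₂ r))

module PartB (t : ℕ) where

  open Cyclic (suc (6 * t))

  module Base (j : Fin t) where

    a : ℕ
    a = suc (toℕ j)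

    a<2a+ : ∀ c → a < 2 * a + c
    a<2a+ c = ≤-trans (m≤m+n (suc a) (toℕ j + c)) (≤-reflexive (shift (toℕ j) c))
      where
      shift : ∀ i c → suc (suc i) + (i + c) ≡ 2 * suc i + c
      shift = solve-∀

    2a+<v : ∀ c → c ≤ 3 * t → 2 * a + c < suc (6 * t)
    2a+<v c c≤3t = s≤s (≤-trans (+-mono-≤ (*-monoʳ-≤ 2 (FinP.toℕ<n j)) c≤3t)
                               (≤-trans (m≤m+n (2 * t + 3 * t) t) (≤-reflexive (total t))))
      where
      total : ∀ t → 2 * t + 3 * t + t ≡ 6 * t
      total = solve-∀

    triangle₁ triangle₂ : Fin (suc (6 * t)) → Block (suc (6 * t))
    triangle₁ s = triangle s a (2 * a + t) z<s (a<2a+ t) (2a+<v t (m≤n*m t 3))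
    triangle₂ s = triangle s a (2 * a + 3 * t) z<s (a<2a+ (3 * t)) (2a+<v (3 * t) ≤-refl)

    orbits : WeightedBlocks (suc (6 * t))
    orbits = weighted triangle₁ (λ _ → 1ℤ) ++ weighted triangle₂ (λ _ → -1ℤ)

    pairs-orbits : ∀ {x y} → x ≢ y →
      pairs orbits x y ≡ differences a (2 * a + t) (diff x y) + differences a (2 * a + 3 * t) (diff x y)
    pairs-orbits {x} {y} x≢y = trans (pairs-++ (weighted triangle₁ (λ _ → 1ℤ)) _ x y) (cong₂ _+_
      (trans (pairs-weighted triangle₁ (λ _ → 1ℤ) x y) (∑-pairs-triangle z<s (a<2a+ t) (2a+<v t (m≤n*m t 3)) x≢y))
      (trans (pairs-weighted triangle₂ (λ _ → -1ℤ) x y) (∑-pairs-triangle z<s (a<2a+ (3 * t)) (2a+<v (3 * t) ≤-refl) x≢y)))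

    flow-orbits : ∀ x → flow orbits x ≡ + 0
    flow-orbits x = trans (flow-++ (weighted triangle₁ (λ _ → 1ℤ)) _ x) (trans (cong₂ _+ℤ_
      (trans (flow-weighted-const triangle₁ 1ℤ x)
             (cong (λ m → + m *ℤ 1ℤ) (∑-incidence-triangle z<s (a<2a+ t) (2a+<v t (m≤n*m t 3)) x)))
      (trans (flow-weighted-const triangle₂ -1ℤ x)
             (cong (λ m → + m *ℤ -1ℤ) (∑-incidence-triangle z<s (a<2a+ (3 * t)) (2a+<v (3 * t) ≤-refl) x))))
      (i*1+i*-1≡0 (+ 3)))

    valid-orbits : All (ValidWeight 3 ∘ proj₂) orbits
    valid-orbits = ++⁺ (valid-weighted triangle₁ (λ _ → 1ℤ) (λ _ → (λ ()) , s≤s (s≤s z≤n)))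
                       (valid-weighted triangle₂ (λ _ → -1ℤ) (λ _ → (λ ()) , s≤s (s≤s z≤n)))

  open Base

  design : WeightedBlocks (suc (6 * t))
  design = ⋃[ j < t ] orbits j

  design-TS₂ : TS₂WithFlow 3 design
  design-TS₂ = record
    { pairs≡2 = λ x y x≢y → trans (pairs-⋃ t orbits x y) (trans (sum-cong-≗ {t} λ j → pairs-orbits j x≢y)
                  (DifferenceFamily.∑-differences t (diff x y) (n≢0⇒n>0 (diff≢0 x≢y)) (s≤s⁻¹ (diff<n x y))))
    ; flow≡0  = λ x → trans (flow-⋃ t orbits x)
                  (trans (ℤΣ.sum-cong-≗ {t} λ j → flow-orbits j x) (ℤΣ.sum-replicate-zero t))
    ; valid   = valid-⋃ t orbits valid-orbits
    }

-- Part (a): a design on {∞} ∪ ℤ/nℤ × ℤ/3ℤ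

alternating : ℕ → ℤ
alternating zero          = 1ℤ
alternating (suc zero)    = -1ℤ
alternating (suc (suc i)) = alternating i

label : ℕ → ℤ
label zero                = + 2
label (suc zero)          = -1ℤ
label (suc (suc zero))    = -1ℤ
label (suc (suc (suc i))) = alternating i

∑-alternating : ∀ m → ℤΣ.sum {m + m} (alternating ∘ toℕ) ≡ + 0
∑-alternating zero = refl
∑-alternating (suc m) = begin
  ℤΣ.sum {suc m + suc m} (alternating ∘ toℕ)        ≡⟨ cong (λ k → ℤΣ.sum {suc k} (alternating ∘ toℕ)) (+-suc m m) ⟩
  1ℤ +ℤ (-1ℤ +ℤ ℤΣ.sum {m + m} (alternating ∘ toℕ)) ≡⟨ cong (λ z → 1ℤ +ℤ (-1ℤ +ℤ z)) (∑-alternating m) ⟩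
  + 0                                                ∎
  where open ≡-Reasoning

∑-label : ∀ m → ℤΣ.sum {3 + (m + m)} (label ∘ toℕ) ≡ + 0
∑-label m = cong (λ z → + 2 +ℤ (-1ℤ +ℤ (-1ℤ +ℤ z))) (∑-alternating m)

label-valid : ∀ i → ValidWeight 5 (label i) × ValidWeight 5 (ℤ.- (+ 2 *ℤ label i))
label-valid zero                = ((λ ()) , s≤s (s≤s (s≤s z≤n))) , ((λ ()) , ≤-refl)
label-valid (suc zero)          = ((λ ()) , s≤s (s≤s z≤n)) , ((λ ()) , s≤s (s≤s (s≤s z≤n)))
label-valid (suc (suc zero))    = ((λ ()) , s≤s (s≤s z≤n)) , ((λ ()) , s≤s (s≤s (s≤s z≤n)))
label-valid (suc (suc (suc i))) = alternating-valid i
  where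
  alternating-valid : ∀ i → ValidWeight 5 (alternating i) × ValidWeight 5 (ℤ.- (+ 2 *ℤ alternating i))
  alternating-valid zero          = ((λ ()) , s≤s (s≤s z≤n)) , ((λ ()) , s≤s (s≤s (s≤s z≤n)))
  alternating-valid (suc zero)    = ((λ ()) , s≤s (s≤s z≤n)) , ((λ ()) , s≤s (s≤s (s≤s z≤n)))
  alternating-valid (suc (suc i)) = alternating-valid i

module PartA (w : ℕ) where

  u n v : ℕ
  u = suc w
  n = suc (u + u)
  v = suc (3 * n)

  open Cyclic n

  ∞ : Fin v
  ∞ = zero

  point : Fin n → Fin 3 → Fin v
  point x l = suc (combine l x)

  point-injective : ∀ x j y k → point x j ≡ point y k → x ≡ y × j ≡ k
  point-injective x j y k eq = cong proj₂ pairs≡ , cong proj₁ pairs≡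
    where
    pairs≡ : (j , x) ≡ (k , y)
    pairs≡ = trans (sym (FinP.remQuot-combine j x))
               (trans (cong (remQuot n) (FinP.suc-injective eq)) (FinP.remQuot-combine k y))

  [point≟point] : ∀ x j y k → [ point x j ≟ point y k ] ≡ [ x ≟ y ] * [ j ≟ k ]
  [point≟point] x j y k = trans
    ([]-⇔ (mk⇔ (point-injective x j y k) (λ { (refl , refl) → refl }))
          (point x j ≟ point y k) ((x ≟ y) ×-dec (j ≟ k)))
    ([]-× (x ≟ y) (j ≟ k))

  data View : Fin v → Set where
    at-∞     : View ∞
    at-point : ∀ x l → View (point x l)

  view : ∀ p → View p
  view zero    = at-∞
  view (suc p) = subst (View ∘ suc) (FinP.combine-remQuot {3} n p)
                       (at-point (proj₂ (remQuot {3} n p)) (proj₁ (remQuot {3} n p)))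

  next : Fin 3 → Fin 3
  next 0F = 1F
  next 1F = 2F
  next 2F = 0F

  next-≢ : ∀ l → l ≢ next l
  next-≢ 0F ()
  next-≢ 1F ()
  next-≢ 2F ()

  level-≢ : ∀ x j y k → j ≢ k → point x j ≢ point y k
  level-≢ x j y k j≢k eq = j≢k (proj₂ (point-injective x j y k eq))

  -- near c = c + 1 and far c ≡ −(c + 1) (mod n), written without truncated subtraction.
  near far : Fin u → ℕ
  near c = suc (toℕ c)
  far c = suc (u + (w ∸ toℕ c))

  far+near≡n : ∀ c → far c + near c ≡ n
  far+near≡n c = begin
    suc (u + (w ∸ toℕ c)) + suc (toℕ c)   ≡⟨ cong suc (+-suc (u + (w ∸ toℕ c)) (toℕ c)) ⟩
    suc (suc (u + (w ∸ toℕ c) + toℕ c))   ≡⟨ cong (λ m → suc (suc m)) (+-assoc u (w ∸ toℕ c) (toℕ c)) ⟩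
    suc (suc (u + (w ∸ toℕ c + toℕ c)))   ≡⟨ cong (λ m → suc (suc (u + m))) (m∸n+n≡m (s≤s⁻¹ (FinP.toℕ<n c))) ⟩
    suc (suc (u + w))                     ≡⟨ cong suc (+-suc u w) ⟨
    n                                     ∎
    where open ≡-Reasoning

  near<n : ∀ c → near c < n
  near<n c = <-≤-trans (m<n+m (near c) {far c} z<s) (≤-reflexive (far+near≡n c))

  far<n : ∀ c → far c < n
  far<n c = <-≤-trans (m<m+n (far c) {near c} z<s) (≤-reflexive (far+near≡n c))

  near<far : ∀ c → near c < far c
  near<far c = s≤s (≤-trans (FinP.toℕ<n c) (m≤m+n u _))

  A : Fin 3 → Fin n → Block v
  A l s = block ∞ (point s l) (point s (next l)) (λ ()) (λ ()) (level-≢ s l s (next l) (next-≢ l))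

  C : Fin n → Block v
  C s = block (point s 0F) (point s 1F) (point s 2F)
    (level-≢ s 0F s 1F (λ ())) (level-≢ s 0F s 2F (λ ())) (level-≢ s 1F s 2F (λ ()))

  Q : Fin 3 → Fin u → Fin n → Block v
  Q l c s = block (point (s ⊕ far c) l) (point (s ⊕ near c) l) (point (s ⊕ 0) (next l))
    (λ eq → <-irrefl (sym (⊕-injective s (far<n c) (near<n c) (proj₁ (point-injective _ l _ l eq)))) (near<far c))
    (level-≢ (s ⊕ far c) l (s ⊕ 0) (next l) (next-≢ l)) (level-≢ (s ⊕ near c) l (s ⊕ 0) (next l) (next-≢ l))

  weightA weightC : Fin n → ℤ
  weightA s = label (toℕ s)
  weightC s = ℤ.- (+ 2 *ℤ label (toℕ s))

  blocksA blocksC blocksQ design : WeightedBlocks v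
  blocksA = ⋃[ l < 3 ] weighted (A l) weightA
  blocksC = weighted C weightC
  blocksQ = ⋃[ l < 3 ] ⋃[ c < u ] cancelling (Q l c)
  design  = blocksA ++ (blocksC ++ blocksQ)

  pairsA pairsC pairsQ : Fin v → Fin v → ℕ
  pairsA p q = ∑[ l < 3 ] ∑[ s < n ] (incidence p (A l s) * incidence q (A l s))
  pairsC p q = ∑[ s < n ] (incidence p (C s) * incidence q (C s))
  pairsQ p q = ∑[ l < 3 ] ∑[ c < u ] (2 * ∑[ s < n ] (incidence p (Q l c s) * incidence q (Q l c s)))

  pairs-design : ∀ p q → pairs design p q ≡ pairsA p q + (pairsC p q + pairsQ p q)
  pairs-design p q = trans (pairs-++ blocksA _ p q) (cong₂ _+_
    (trans (pairs-⋃ 3 (λ l → weighted (A l) weightA) p q) (sum-cong-≗ {3} λ l → pairs-weighted (A l) weightA p q))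
    (trans (pairs-++ blocksC blocksQ p q) (cong₂ _+_
      (pairs-weighted C weightC p q)
      (trans (pairs-⋃ 3 (λ l → ⋃[ c < u ] cancelling (Q l c)) p q) (sum-cong-≗ {3} λ l →
        trans (pairs-⋃ u (λ c → cancelling (Q l c)) p q) (sum-cong-≗ {u} λ c → pairs-cancelling (Q l c) p q))))))

  flowA flowC : Fin v → ℤ
  flowA p = ℤΣ.sum {3} λ l → ℤΣ.sum {n} λ s → + incidence p (A l s) *ℤ weightA s
  flowC p = ℤΣ.sum {n} λ s → + incidence p (C s) *ℤ weightC s

  flow-design : ∀ p → flow design p ≡ flowA p +ℤ flowC p
  flow-design p = trans (flow-++ blocksA _ p) (cong₂ _+ℤ_
    (trans (flow-⋃ 3 (λ l → weighted (A l) weightA) p) (ℤΣ.sum-cong-≗ {3} λ l → flow-weighted (A l) weightA p))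
    (trans (flow-++ blocksC blocksQ p)
           (trans (cong₂ _+ℤ_ (flow-weighted C weightC p) flowQ≡0) (ℤP.+-identityʳ (flowC p)))))
    where
    flowQ≡0 : flow blocksQ p ≡ + 0
    flowQ≡0 = trans (flow-⋃ 3 (λ l → ⋃[ c < u ] cancelling (Q l c)) p) (trans (ℤΣ.sum-cong-≗ {3} λ l →
                trans (flow-⋃ u (λ c → cancelling (Q l c)) p)
                  (trans (ℤΣ.sum-cong-≗ {u} λ c → flow-cancelling (Q l c) p) (ℤΣ.sum-replicate-zero u)))
                (ℤΣ.sum-replicate-zero 3))

  covers : Fin 3 → Fin 3 → ℕ
  covers j l = [ j ≟ l ] + [ j ≟ next l ]

  ∑-covers : ∀ j → ∑[ l < 3 ] covers j l ≡ 2
  ∑-covers 0F = refl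
  ∑-covers 1F = refl
  ∑-covers 2F = refl

  incidence-A : ∀ x j l s → incidence (point x j) (A l s) ≡ [ x ≟ s ] * covers j l
  incidence-A x j l s = trans (cong₂ _+_ ([point≟point] x j s l) ([point≟point] x j s (next l)))
                              (sym (*-distribˡ-+ [ x ≟ s ] [ j ≟ l ] [ j ≟ next l ]))

  incidence-C : ∀ x j s → incidence (point x j) (C s) ≡ [ x ≟ s ] * 1
  incidence-C x j s = trans
    (cong₂ _+_ (cong₂ _+_ ([point≟point] x j s 0F) ([point≟point] x j s 1F)) ([point≟point] x j s 2F))
    (trans (factor [ x ≟ s ] [ j ≟ 0F ] [ j ≟ 1F ] [ j ≟ 2F ]) (cong (_*_ [ x ≟ s ]) (one-level j)))
    where
    factor : ∀ a b c d → a * b + a * c + a * d ≡ a * (b + c + d)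
    factor = solve-∀
    one-level : ∀ j → [ j ≟ 0F ] + [ j ≟ 1F ] + [ j ≟ 2F ] ≡ 1
    one-level 0F = refl
    one-level 1F = refl
    one-level 2F = refl

  ∑-weightA : ℤΣ.sum weightA ≡ + 0
  ∑-weightA = trans (cong (λ k → ℤΣ.sum {suc k} (label ∘ toℕ)) (+-suc (suc w) w)) (∑-label w)

  flow-∞ : flow design ∞ ≡ + 0
  flow-∞ = begin
    flow design ∞                                             ≡⟨ flow-design ∞ ⟩
    flowA ∞ +ℤ flowC ∞                                        ≡⟨ cong₂ _+ℤ_ A-part (ℤΣ.sum-replicate-zero n) ⟩
    + 0                                                       ∎
    where
    open ≡-Reasoning
    A-part : flowA ∞ ≡ + 0
    A-part = trans (ℤΣ.sum-cong-≗ {3} λ l → trans (ℤΣ.sum-cong-≗ {n} λ s → ℤP.*-identityˡ (weightA s)) ∑-weightA)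
                   (ℤΣ.sum-replicate-zero 3)

  flow-point : ∀ x j → flow design (point x j) ≡ + 0
  flow-point x j = begin
    flow design (point x j)                         ≡⟨ flow-design (point x j) ⟩
    flowA (point x j) +ℤ flowC (point x j)          ≡⟨ cong₂ _+ℤ_ A-part C-part ⟩
    + 2 *ℤ weightA x +ℤ ℤ.- (+ 2 *ℤ weightA x)      ≡⟨ ℤP.+-inverseʳ (+ 2 *ℤ weightA x) ⟩
    + 0                                             ∎
    where
    open ≡-Reasoning
    A-part : flowA (point x j) ≡ + 2 *ℤ weightA x
    A-part = begin
      flowA (point x j)
        ≡⟨ ℤΣ.sum-cong-≗ {3} (λ l → trans (ℤΣ.sum-cong-≗ {n} λ s → cong (λ m → + m *ℤ weightA s) (incidence-A x j l s))
                                          (ℤ∑-select-scaled x (covers j l) weightA)) ⟩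
      ℤΣ.sum (λ l → + covers j l *ℤ weightA x)   ≡⟨ ℤ∑-scale (covers j) (weightA x) ⟩
      + (∑[ l < 3 ] covers j l) *ℤ weightA x     ≡⟨ cong (λ m → + m *ℤ weightA x) (∑-covers j) ⟩
      + 2 *ℤ weightA x                           ∎
    C-part : flowC (point x j) ≡ ℤ.- (+ 2 *ℤ weightA x)
    C-part = trans (ℤΣ.sum-cong-≗ {n} λ s → cong (λ m → + m *ℤ weightC s) (incidence-C x j s))
                   (trans (ℤ∑-select-scaled x 1 weightC) (ℤP.*-identityˡ (weightC x)))

  offset : Fin u → Fin 3 → ℕ
  offset c 0F = far c
  offset c 1F = near c
  offset c 2F = 0

  offset≤n : ∀ c i → offset c i ≤ n
  offset≤n c 0F = <⇒≤ (far<n c)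
  offset≤n c 1F = <⇒≤ (near<n c)
  offset≤n c 2F = z≤n

  level : Fin 3 → Fin 3 → Fin 3
  level l 0F = l
  level l 1F = l
  level l 2F = next l

  incidence-Q : ∀ x j l c s → incidence (point x j) (Q l c s) ≡ ∑[ i < 3 ] ([ x ≟ s ⊕ offset c i ] * [ j ≟ level l i ])
  incidence-Q x j l c s = trans
    (cong₂ _+_ (cong₂ _+_ ([point≟point] x j (s ⊕ far c) l) ([point≟point] x j (s ⊕ near c) l))
               ([point≟point] x j (s ⊕ 0) (next l)))
    (as-sum ([ x ≟ s ⊕ far c ] * [ j ≟ l ]) ([ x ≟ s ⊕ near c ] * [ j ≟ l ]) ([ x ≟ s ⊕ 0 ] * [ j ≟ next l ]))
    where
    as-sum : ∀ a b c → a + b + c ≡ a + (b + (c + 0))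
    as-sum a b c = trans (+-assoc a b c) (cong (λ m → a + (b + m)) (sym (+-identityʳ c)))

  shifts : Fin n → Fin n → Fin 3 → Fin 3 → ℕ
  shifts x y i i′ = ∑[ c < u ] [ y ≟ x ⊕ (n ∸ offset c i + offset c i′) ]

  coefficient : Fin 3 → Fin 3 → Fin 3 → Fin 3 → Fin 3 → ℕ
  coefficient j k l i i′ = [ j ≟ level l i ] * [ k ≟ level l i′ ]

  pairsQ-shifts : ∀ x j y k →
    pairsQ (point x j) (point y k) ≡ 2 * ∑[ l < 3 ] ∑[ i < 3 ] ∑[ i′ < 3 ] (shifts x y i i′ * coefficient j k l i i′)
  pairsQ-shifts x j y k = begin
    pairsQ (point x j) (point y k)
      ≡⟨ sum-cong-≗ {3} (λ l → sum-cong-≗ {u} λ c → cong (2 *_) (translated l c)) ⟩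
    ∑[ l < 3 ] ∑[ c < u ] (2 * ∑[ i < 3 ] ∑[ i′ < 3 ] T l c i i′)
      ≡⟨ sum-cong-≗ {3} (λ l → *-distribˡ-sum 2 (λ c → ∑[ i < 3 ] ∑[ i′ < 3 ] T l c i i′)) ⟨
    ∑[ l < 3 ] (2 * ∑[ c < u ] ∑[ i < 3 ] ∑[ i′ < 3 ] T l c i i′)
      ≡⟨ *-distribˡ-sum 2 (λ l → ∑[ c < u ] ∑[ i < 3 ] ∑[ i′ < 3 ] T l c i i′) ⟨
    2 * ∑[ l < 3 ] ∑[ c < u ] ∑[ i < 3 ] ∑[ i′ < 3 ] T l c i i′
      ≡⟨ cong (2 *_) (sum-cong-≗ {3} λ l → trans (∑-comm (λ c i → ∑[ i′ < 3 ] T l c i i′))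
                                               (sum-cong-≗ {3} λ i → ∑-comm (λ c i′ → T l c i i′))) ⟩
    2 * ∑[ l < 3 ] ∑[ i < 3 ] ∑[ i′ < 3 ] ∑[ c < u ] T l c i i′
      ≡⟨ cong (2 *_) (sum-cong-≗ {3} λ l → sum-cong-≗ {3} λ i → sum-cong-≗ {3} λ i′ →
           *-distribʳ-sum (coefficient j k l i i′) (λ c → [ y ≟ x ⊕ (n ∸ offset c i + offset c i′) ])) ⟨
    2 * ∑[ l < 3 ] ∑[ i < 3 ] ∑[ i′ < 3 ] (shifts x y i i′ * coefficient j k l i i′) ∎
    where
    open ≡-Reasoning
    T : Fin 3 → Fin u → Fin 3 → Fin 3 → ℕ
    T l c i i′ = [ y ≟ x ⊕ (n ∸ offset c i + offset c i′) ] * coefficient j k l i i′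
    translated : ∀ l c → ∑[ s < n ] (incidence (point x j) (Q l c s) * incidence (point y k) (Q l c s))
                         ≡ ∑[ i < 3 ] ∑[ i′ < 3 ] T l c i i′
    translated l c = trans (sum-cong-≗ {n} λ s → cong₂ _*_ (incidence-Q x j l c s) (incidence-Q y k l c s))
                           (∑-translates (offset c) (offset≤n c) (λ i → [ j ≟ level l i ]) (λ i → [ k ≟ level l i ]) x y)

  module _ (x y : Fin n) where

    shifts-diagonal : x ≢ y → ∀ i → shifts x y i i ≡ 0
    shifts-diagonal x≢y i = ∑-zero λ c → [≟⊕∸+]≡0 x≢y (offset c i) (offset≤n c i)

    shifts₀₁ : shifts x y 0F 1F ≡ ∑[ c < u ] [ near c + near c ≟ℕ diff x y ]
    shifts₀₁ = sum-cong-≗ {u} λ c → [≟⊕]≡[≟diff] x y (near c + near c)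
      (cong (λ m → x ⊕ (m + near c)) (o∸m≡n (far c) (near c) (far+near≡n c)))
      (s≤s (+-mono-≤ (FinP.toℕ<n c) (FinP.toℕ<n c)))

    shifts₁₀ : shifts x y 1F 0F ≡ ∑[ c < u ] [ 1 + 2 * (w ∸ toℕ c) ≟ℕ diff x y ]
    shifts₁₀ = sum-cong-≗ {u} λ c → [≟⊕]≡[≟diff] x y (1 + 2 * (w ∸ toℕ c))
      (trans (cong (λ m → x ⊕ (m + far c)) (o∸m≡n (near c) (far c) (trans (+-comm (near c) (far c)) (far+near≡n c))))
             (trans (cong (x ⊕_) (far+far w (w ∸ toℕ c))) (⊕-n+ x (1 + 2 * (w ∸ toℕ c)))))
      (s≤s (s≤s (+-mono-≤ (m∸n≤m w (toℕ c))
                          (≤-trans (≤-reflexive (+-identityʳ (w ∸ toℕ c))) (≤-trans (m∸n≤m w (toℕ c)) (n≤1+n w))))))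
      where
      far+far : ∀ w r → suc (suc w + r) + suc (suc w + r) ≡ suc (suc w + suc w) + (1 + 2 * r)
      far+far = solve-∀

    shifts₀₂ : shifts x y 0F 2F ≡ ∑[ c < u ] [ near c ≟ℕ diff x y ]
    shifts₀₂ = sum-cong-≗ {u} λ c → [≟⊕]≡[≟diff] x y (near c)
      (cong (x ⊕_) (trans (+-identityʳ (n ∸ far c)) (o∸m≡n (far c) (near c) (far+near≡n c)))) (near<n c)

    shifts₁₂ : shifts x y 1F 2F ≡ ∑[ c < u ] [ far c ≟ℕ diff x y ]
    shifts₁₂ = sum-cong-≗ {u} λ c → [≟⊕]≡[≟diff] x y (far c)
      (cong (x ⊕_) (trans (+-identityʳ (n ∸ near c)) (o∸m≡n (near c) (far c) (trans (+-comm (near c) (far c)) (far+near≡n c)))))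
      (far<n c)

    shifts₂₀ : shifts x y 2F 0F ≡ ∑[ c < u ] [ far c ≟ℕ diff x y ]
    shifts₂₀ = sum-cong-≗ {u} λ c → [≟⊕]≡[≟diff] x y (far c) (⊕-n+ x (far c)) (far<n c)

    shifts₂₁ : shifts x y 2F 1F ≡ ∑[ c < u ] [ near c ≟ℕ diff x y ]
    shifts₂₁ = sum-cong-≗ {u} λ c → [≟⊕]≡[≟diff] x y (near c) (⊕-n+ x (near c)) (near<n c)

  module _ {D : ℕ} (1≤D : 1 ≤ D) (D<n : D < n) where

    same-level : ∑[ c < u ] [ near c + near c ≟ℕ D ] + ∑[ c < u ] [ 1 + 2 * (w ∸ toℕ c) ≟ℕ D ] ≡ 1
    same-level = begin
      ∑[ c < u ] [ near c + near c ≟ℕ D ] + ∑[ c < u ] [ 1 + 2 * (w ∸ toℕ c) ≟ℕ D ]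
        ≡⟨ cong₂ _+_ (sum-cong-≗ {u} λ c → cong (λ e → [ e ≟ℕ D ]) (twice (toℕ c))) (∑-reverse u (λ r → [ 1 + 2 * r ≟ℕ D ])) ⟩
      ∑[ c < u ] [ suc (1 + 2 * toℕ c) ≟ℕ D ] + ∑[ c < u ] [ 1 + 2 * toℕ c ≟ℕ D ]
        ≡⟨ +-comm (∑[ c < u ] [ suc (1 + 2 * toℕ c) ≟ℕ D ]) _ ⟩
      ∑[ c < u ] [ 1 + 2 * toℕ c ≟ℕ D ] + ∑[ c < u ] [ suc (1 + 2 * toℕ c) ≟ℕ D ]
        ≡⟨ ∑-distrib-+ {u} (λ c → [ 1 + 2 * toℕ c ≟ℕ D ]) (λ c → [ suc (1 + 2 * toℕ c) ≟ℕ D ]) ⟨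
      ∑[ c < u ] ([ 1 + 2 * toℕ c ≟ℕ D ] + [ suc (1 + 2 * toℕ c) ≟ℕ D ])
        ≡⟨ rangeCount-pairs 1 u D ⟩
      rangeCount 1 (u + u) D
        ≡⟨ rangeCount-hit 1 (u + u) D 1≤D D<n ⟩
      1 ∎
      where
      open ≡-Reasoning
      twice : ∀ c → suc c + suc c ≡ suc (1 + 2 * c)
      twice = solve-∀

    adjacent-level : ∑[ c < u ] [ near c ≟ℕ D ] + ∑[ c < u ] [ far c ≟ℕ D ] ≡ 1
    adjacent-level = begin
      rangeCount 1 u D + ∑[ c < u ] [ suc (u + (w ∸ toℕ c)) ≟ℕ D ]
        ≡⟨ cong (_+_ (rangeCount 1 u D)) (∑-reverse u (λ r → [ suc (u + r) ≟ℕ D ])) ⟩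
      rangeCount 1 u D + rangeCount (suc u) u D
        ≡⟨ rangeCount-merge 1 u u D refl ⟩
      rangeCount 1 (u + u) D
        ≡⟨ rangeCount-hit 1 (u + u) D 1≤D D<n ⟩
      1 ∎
      where open ≡-Reasoning

  -- Two levels in ℤ/3ℤ are either equal or adjacent, in exactly one way.
  adjacency : ∀ j k →
    ∑[ l < 3 ] (1 * ([ j ≟ l ] * [ k ≟ l ]) + 1 * ([ j ≟ l ] * [ k ≟ next l ]) + 1 * ([ j ≟ next l ] * [ k ≟ l ])) ≡ 1
  adjacency 0F 0F = refl
  adjacency 0F 1F = refl
  adjacency 0F 2F = refl
  adjacency 1F 0F = refl
  adjacency 1F 1F = refl
  adjacency 1F 2F = refl
  adjacency 2F 0F = refl
  adjacency 2F 1F = refl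
  adjacency 2F 2F = refl

  pairsQ-distinct : ∀ x j y k → x ≢ y → pairsQ (point x j) (point y k) ≡ 2
  pairsQ-distinct x j y k x≢y = begin
    pairsQ (point x j) (point y k)
      ≡⟨ pairsQ-shifts x j y k ⟩
    2 * ∑[ l < 3 ] ∑[ i < 3 ] ∑[ i′ < 3 ] (Sh i i′ * coefficient j k l i i′)
      ≡⟨ cong (2 *_) (sum-cong-≗ {3} per-level) ⟩
    2 * ∑[ l < 3 ] (1 * e l + 1 * a l + 1 * b l)
      ≡⟨ cong (2 *_) (adjacency j k) ⟩
    2 ∎
    where
    open ≡-Reasoning
    Sh : Fin 3 → Fin 3 → ℕ
    Sh = shifts x y
    e a b : Fin 3 → ℕ
    e l = [ j ≟ l ] * [ k ≟ l ]
    a l = [ j ≟ l ] * [ k ≟ next l ]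
    b l = [ j ≟ next l ] * [ k ≟ l ]
    1≤D : 1 ≤ diff x y
    1≤D = n≢0⇒n>0 (diff≢0 x≢y)
    D<n : diff x y < n
    D<n = diff<n x y
    R : Sh 0F 1F + Sh 1F 0F ≡ 1
    R = trans (cong₂ _+_ (shifts₀₁ x y) (shifts₁₀ x y)) (same-level 1≤D D<n)
    M : Sh 0F 2F + Sh 1F 2F ≡ 1
    M = trans (cong₂ _+_ (shifts₀₂ x y) (shifts₁₂ x y)) (adjacent-level 1≤D D<n)
    M′ : Sh 2F 0F + Sh 2F 1F ≡ 1
    M′ = trans (cong₂ _+_ (shifts₂₀ x y) (shifts₂₁ x y))
           (trans (+-comm (∑[ c < u ] [ far c ≟ℕ diff x y ]) _) (adjacent-level 1≤D D<n))
    regroup : ∀ s₀₁ s₀₂ s₁₂ s₁₀ s₂₀ s₂₁ e a b →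
      s₀₁ * e + s₀₂ * a + s₁₂ * a + s₁₀ * e + s₂₀ * b + s₂₁ * b ≡ (s₀₁ + s₁₀) * e + (s₀₂ + s₁₂) * a + (s₂₀ + s₂₁) * b
    regroup = solve-∀
    per-level : ∀ l → ∑[ i < 3 ] ∑[ i′ < 3 ] (Sh i i′ * coefficient j k l i i′) ≡ 1 * e l + 1 * a l + 1 * b l
    per-level l = begin
      ∑[ i < 3 ] ∑[ i′ < 3 ] (Sh i i′ * coefficient j k l i i′)
        ≡⟨ ∑₃∑₃ (λ i i′ → Sh i i′ * coefficient j k l i i′) ⟩
      Sh 0F 0F * e l + Sh 1F 1F * e l + Sh 2F 2F * ([ j ≟ next l ] * [ k ≟ next l ])
        + (Sh 0F 1F * e l + Sh 0F 2F * a l + Sh 1F 2F * a l + Sh 1F 0F * e l + Sh 2F 0F * b l + Sh 2F 1F * b l)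
        ≡⟨ cong₂ _+_ (cong₂ _+_ (cong₂ _+_ (vanish 0F) (vanish 1F)) (vanish 2F))
                     (regroup (Sh 0F 1F) (Sh 0F 2F) (Sh 1F 2F) (Sh 1F 0F) (Sh 2F 0F) (Sh 2F 1F) (e l) (a l) (b l)) ⟩
      (Sh 0F 1F + Sh 1F 0F) * e l + (Sh 0F 2F + Sh 1F 2F) * a l + (Sh 2F 0F + Sh 2F 1F) * b l
        ≡⟨ cong₂ _+_ (cong₂ _+_ (cong (_* e l) R) (cong (_* a l) M)) (cong (_* b l) M′) ⟩
      1 * e l + 1 * a l + 1 * b l ∎
      where
      vanish : ∀ i → Sh i i * coefficient j k l i i ≡ 0
      vanish i = cong (_* coefficient j k l i i) (shifts-diagonal x y x≢y i)

  -- The two points of a level in Q l c s have distinct residues, and far c, near c ≢ 0 (mod n).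
  pairsQ-same : ∀ x j k → j ≢ k → pairsQ (point x j) (point x k) ≡ 0
  pairsQ-same x j k j≢k =
    trans (pairsQ-shifts x j x k) (cong (2 *_) (∑-zero λ l → ∑-zero λ i → ∑-zero λ i′ → vanish l i i′))
    where
    distinct-levels : ∀ m → [ j ≟ m ] * [ k ≟ m ] ≡ 0
    distinct-levels m with j ≟ m
    ... | yes refl = trans (+-identityʳ [ k ≟ m ]) ([]-no (k ≟ m) (j≢k ∘ sym))
    ... | no _     = refl
    same : ∀ S m → S * ([ j ≟ m ] * [ k ≟ m ]) ≡ 0
    same S m = trans (cong (S *_) (distinct-levels m)) (*-zeroʳ S)
    from-diff : (f : Fin u → ℕ) → (∀ c → [ f c ≟ℕ 0 ] ≡ 0) → ∑[ c < u ] [ f c ≟ℕ diff x x ] ≡ 0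
    from-diff f f≢0 = trans (cong (λ D → ∑[ c < u ] [ f c ≟ℕ D ]) (diff-self x)) (∑-zero f≢0)
    vanish : ∀ l i i′ → shifts x x i i′ * coefficient j k l i i′ ≡ 0
    vanish l 0F 0F = same (shifts x x 0F 0F) l
    vanish l 0F 1F = same (shifts x x 0F 1F) l
    vanish l 1F 0F = same (shifts x x 1F 0F) l
    vanish l 1F 1F = same (shifts x x 1F 1F) l
    vanish l 2F 2F = same (shifts x x 2F 2F) (next l)
    vanish l 0F 2F = cong (_* coefficient j k l 0F 2F) (trans (shifts₀₂ x x) (from-diff near (λ _ → refl)))
    vanish l 1F 2F = cong (_* coefficient j k l 1F 2F) (trans (shifts₁₂ x x) (from-diff far (λ _ → refl)))
    vanish l 2F 0F = cong (_* coefficient j k l 2F 0F) (trans (shifts₂₀ x x) (from-diff far (λ _ → refl)))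
    vanish l 2F 1F = cong (_* coefficient j k l 2F 1F) (trans (shifts₂₁ x x) (from-diff near (λ _ → refl)))

  pairs-∞-point : ∀ y k → pairs design ∞ (point y k) ≡ 2
  pairs-∞-point y k = trans (pairs-design ∞ (point y k)) (cong₂ _+_ A-part (cong₂ _+_ (sum-replicate-zero n) Q-part))
    where
    Q-part : pairsQ ∞ (point y k) ≡ 0
    Q-part = ∑-zero λ l → ∑-zero λ c → no-∞ l c
      where
      no-∞ : ∀ l c → 2 * ∑[ s < n ] (incidence ∞ (Q l c s) * incidence (point y k) (Q l c s)) ≡ 0
      no-∞ l c = cong (2 *_) (sum-replicate-zero n)
    A-part : pairsA ∞ (point y k) ≡ 2
    A-part = trans (sum-cong-≗ {3} λ l → trans (sum-cong-≗ {n} λ s → trans (*-identityˡ _) (incidence-A y k l s))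
                                              (∑-select-const y (covers k l)))
                   (∑-covers k)

  covers-distinct : ∀ j k → j ≢ k → ∑[ l < 3 ] (1 * (covers j l * covers k l)) ≡ 1
  covers-distinct 0F 0F j≢k = ⊥-elim (j≢k refl)
  covers-distinct 0F 1F _   = refl
  covers-distinct 0F 2F _   = refl
  covers-distinct 1F 0F _   = refl
  covers-distinct 1F 1F j≢k = ⊥-elim (j≢k refl)
  covers-distinct 1F 2F _   = refl
  covers-distinct 2F 0F _   = refl
  covers-distinct 2F 1F _   = refl
  covers-distinct 2F 2F j≢k = ⊥-elim (j≢k refl)

  pairs-points : ∀ x j y k → point x j ≢ point y k → pairs design (point x j) (point y k) ≡ 2
  pairs-points x j y k p≢q = trans (pairs-design (point x j) (point y k)) (by-residues (x ≟ y))
    where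
    A-part : pairsA (point x j) (point y k) ≡ ∑[ l < 3 ] ([ y ≟ x ] * (covers j l * covers k l))
    A-part = sum-cong-≗ {3} λ l → trans (sum-cong-≗ {n} λ s → cong₂ _*_ (incidence-A x j l s) (incidence-A y k l s))
                                        (∑-select-pair x y (covers j l) (covers k l))
    C-part : pairsC (point x j) (point y k) ≡ [ y ≟ x ] * (1 * 1)
    C-part = trans (sum-cong-≗ {n} λ s → cong₂ _*_ (incidence-C x j s) (incidence-C y k s)) (∑-select-pair x y 1 1)
    by-residues : Dec (x ≡ y) →
      pairsA (point x j) (point y k) + (pairsC (point x j) (point y k) + pairsQ (point x j) (point y k)) ≡ 2
    by-residues (yes refl) = cong₂ _+_
      (trans A-part (trans (sum-cong-≗ {3} λ l → cong (_* (covers j l * covers k l)) ([]-yes (x ≟ x) refl))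
                           (covers-distinct j k j≢k)))
      (cong₂ _+_ (trans C-part (cong (_* 1) ([]-yes (x ≟ x) refl))) (pairsQ-same x j k j≢k))
      where
      j≢k : j ≢ k
      j≢k refl = p≢q refl
    by-residues (no x≢y) = cong₂ _+_
      (trans A-part (∑-zero λ l → cong (_* (covers j l * covers k l)) ([]-no (y ≟ x) (x≢y ∘ sym))))
      (cong₂ _+_ (trans C-part (cong (_* 1) ([]-no (y ≟ x) (x≢y ∘ sym)))) (pairsQ-distinct x j y k x≢y))

  pairs-by-view : ∀ {p q} → View p → View q → p ≢ q → pairs design p q ≡ 2
  pairs-by-view at-∞           at-∞           p≢q = ⊥-elim (p≢q refl)
  pairs-by-view at-∞           (at-point y k) _   = pairs-∞-point y k
  pairs-by-view (at-point x j) at-∞           _   = trans (pairs-sym design (point x j) ∞) (pairs-∞-point x j)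
  pairs-by-view (at-point x j) (at-point y k) p≢q = pairs-points x j y k p≢q

  flow-by-view : ∀ {p} → View p → flow design p ≡ + 0
  flow-by-view at-∞           = flow-∞
  flow-by-view (at-point x j) = flow-point x j

  design-TS₂ : TS₂WithFlow 5 design
  design-TS₂ = record
    { pairs≡2 = λ p q → pairs-by-view (view p) (view q)
    ; flow≡0  = λ p → flow-by-view (view p)
    ; valid   = ++⁺ (valid-⋃ 3 (λ l → weighted (A l) weightA) λ l →
                       valid-weighted (A l) weightA (λ s → proj₁ (label-valid (toℕ s))))
                    (++⁺ (valid-weighted C weightC (λ s → proj₂ (label-valid (toℕ s))))
                         (valid-⋃ 3 (λ l → ⋃[ c < u ] cancelling (Q l c)) λ l →
                            valid-⋃ u (λ c → cancelling (Q l c)) λ c → valid-cancelling (Q l c) (s≤s (s≤s z≤n))))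
    }

residue : ∀ m r → m % 6 ≡ r → m ≡ r + m / 6 * 6
residue m r eq = trans (m≡m%n+[m/n]*n m 6) (cong (_+ m / 6 * 6) eq)

lam≡m*2 : ∀ lam → lam % 6 ≡ 2 ⊎ lam % 6 ≡ 4 → Σ ℕ λ m → lam ≡ m * 2
lam≡m*2 lam (inj₁ eq) = suc (3 * (lam / 6)) , trans (residue lam 2 eq) (halve (lam / 6))
  where
  halve : ∀ q → 2 + q * 6 ≡ suc (3 * q) * 2
  halve = solve-∀
lam≡m*2 lam (inj₂ eq) = suc (suc (3 * (lam / 6))) , trans (residue lam 4 eq) (halve (lam / 6))
  where
  halve : ∀ q → 4 + q * 6 ≡ suc (suc (3 * q)) * 2
  halve = solve-∀

mainTheorem2 :
    ((v lam : ℕ) → v % 6 ≡ 4 → v ≢ 4 → (lam % 6 ≡ 2 ⊎ lam % 6 ≡ 4) →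
      HasTSWithFlow v lam 5)
    × ((v lam : ℕ) → v % 6 ≡ 1 → v ≢ 7 → v ≢ 19 → (lam % 6 ≡ 2 ⊎ lam % 6 ≡ 4) →
      HasTSWithFlow v lam 3)
mainTheorem2 = part-a , part-b
  where
  part-a : (v lam : ℕ) → v % 6 ≡ 4 → v ≢ 4 → (lam % 6 ≡ 2 ⊎ lam % 6 ≡ 4) → HasTSWithFlow v lam 5
  part-a v lam v%6≡4 v≢4 lam%6 with lam≡m*2 lam lam%6 | v / 6 | residue v 4 v%6≡4
  ... | m , refl | zero  | v≡4 = ⊥-elim (v≢4 v≡4)
  ... | m , refl | suc w | refl = subst (λ v′ → HasTSWithFlow v′ (m * 2) 5) (points w)
                                        (TS₂WithFlow⇒HasTSWithFlow (PartA.design-TS₂ w) m)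
    where
    points : ∀ w → suc (3 * suc (suc w + suc w)) ≡ 4 + suc w * 6
    points = solve-∀

  -- The construction works for v = 7 and v = 19 as well.
  part-b : (v lam : ℕ) → v % 6 ≡ 1 → v ≢ 7 → v ≢ 19 → (lam % 6 ≡ 2 ⊎ lam % 6 ≡ 4) → HasTSWithFlow v lam 3
  part-b v lam v%6≡1 _ _ lam%6 with lam≡m*2 lam lam%6 | v / 6 | residue v 1 v%6≡1
  ... | m , refl | t | refl = subst (λ v′ → HasTSWithFlow v′ (m * 2) 3) (points t)
                                    (TS₂WithFlow⇒HasTSWithFlow (PartB.design-TS₂ t) m)
    where
    points : ∀ t → suc (6 * t) ≡ 1 + t * 6
    points = solve-∀
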